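{- Let $J$ be a non-cyclic $k$-subset of $[n]$, and let $(\mathbf{r},\mathbf{S})=((r_1,\dots,r_\ell),(S_1,\dots,S_\ell))$ be its decorated ordered set partition. Let $\mathcal{B}$ be the set of $B\in\binom{[n]}{k}$ such that $|B\cap(S_1\cup\dots\cup S_a)|\ge r_1+\dots+r_a$ for all $a=1,\dots,\ell-1$. Define $\mathrm{corank}(I)=k-\max_{B\in\mathcal{B}}|I\cap B|$, and view it as the vector $\sum_I\mathrm{corank}(I)e^I\in\mathbb{R}^{\binom{[n]}{k}}$. Then $$\mathfrak{h}_J\equiv\mathrm{corank}\pmod{L_{k,n}}.$$
   Context: Fix $2\le k<n$, with indices mod $n$. A $k$-subset is cyclic if it is a cyclic interval $\{a,\dots,a+k-1\}$ (mod $n$). Lineality and planar basis. $L_{k,n}=\mathrm{span}\{\sum_{I\ni i}e^I: i\in[n]\}\subseteq\mathbb{R}^{\binom{[n]}{k}}$, where $\{e^I\}$ is the standard basis. The planar basis element is $\mathfrak{h}_J=\frac1n\sum_I d(e_J,e_I)e^I$, where $e_J=\sum_{j\in J}e_j\in\mathbb{R}^n$ and $d(e_J,e_I)$ is the minimal number of steps, each adding some $e_i-e_{i+1}$ (mod $n$) while staying among $0/1$ vectors with $k$ ones, from $e_J$ to $e_I$. Decorated ordered set partition of $J$. Arrange $[n]$ on a circle. The elements of $J$ form maximal runs $I_1,\dots,I_\ell$ of cyclically consecutive integers. Each $I_a$ is immediately preceded on the circle by a maximal gap $C_a\subseteq[n]\setminus J$ of cyclically consecutive integers. The labeling is such that $1\in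 C_1\cup I_1$ and the blocks occur in cyclic order. Set $S_a=C_a\cup I_a$ and $r_a=|I_a|$. -}

module Defs where

open import Data.Bool using (Bool; true; false; if_then_else_; _∧_)
open import Data.Nat using (ℕ; zero; suc; _+_; _∸_; _≤_; _<_; _<ᵇ_; _≤ᵇ_; _≡ᵇ_; _⊔_; NonZero)
open import Data.Nat.DivMod using (_%_; m%n<n)
open import Data.Fin using (Fin; toℕ; fromℕ<)
open import Data.Fin.Subset using (Subset; inside; outside; _∈_; _∉_; _∩_; ∣_∣)
import Data.Vec
open import Data.Vec using (Vec; []; _∷_; tabulate; _[_]≔_)
import Data.List
open import Data.List using (List; map; foldr; upTo; _++_)

open import Data.Product using (Σ; ∃; _×_; _,_)
open import Data.Integer using (+_)
open import Data.Rational using (ℚ; 0ℚ) renaming (_+_ to _+ℚ_)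
open import Relation.Binary.PropositionalEquality using (_≡_; _≢_)
open import Relation.Nullary using (¬_)
open import Function.Bundles using (_⇔_)

-- Positions 0,…,n-1 stand for 1,…,n (0-based); indices are cyclic mod n.

next : ∀ {n} {{_ : NonZero n}} → Fin n → Fin n
next {n} i = fromℕ< (m%n<n (suc (toℕ i)) n)

offset : ∀ {n} {{_ : NonZero n}} → Fin n → Fin n → ℕ
offset {n} s p = (toℕ p + (n ∸ toℕ s)) % n

cycInterval : ∀ {n} {{_ : NonZero n}} → Fin n → ℕ → Subset n
cycInterval s len = tabulate (λ p → offset s p <ᵇ len)

NonCyclic : ∀ {n} {{_ : NonZero n}} → ℕ → Subset n → Set
NonCyclic k J = ∀ a → J ≢ cycInterval a k

sumTo : ∀ {ℓ} → (Fin ℓ → ℕ) → ℕ → ℕ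
sumTo {zero}  f a       = 0
sumTo {suc ℓ} f zero    = 0
sumTo {suc ℓ} f (suc a) = f Fin.zero + sumTo (λ b → f (Fin.suc b)) a

-- Going around the circle from 'start' (the first element of C_1) one
-- meets C_1 (length c 0), I_1 (length r 0), C_2, I_2, …, C_ℓ, I_ℓ,
-- covering [n] exactly once; the I_a are the runs of J, the C_a the gaps,
-- all nonempty (so they are maximal), and position 0 (i.e. "1") lies in
-- S_1 = C_1 ∪ I_1.  Block a (0-based) is S_{a+1}.

record DOSP {n} {{_ : NonZero n}} (J : Subset n) : Set where
  field
    ℓ     : ℕ
    c r   : Fin ℓ → ℕ
    c-pos : ∀ a → 1 ≤ c a
    r-pos : ∀ a → 1 ≤ r a
    start : Fin n
  len : Fin ℓ → ℕ
  len a = c a + r a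
  -- offsets (from start) lying in I_{a+1}
  InRun : ℕ → Set
  InRun t = Σ (Fin ℓ) λ a → (sumTo len (toℕ a) + c a ≤ t) × (t < sumTo len (suc (toℕ a)))
  field
    total     : sumTo len ℓ ≡ n
    members   : ∀ p → (p ∈ J) ⇔ InRun (offset start p)
    oneInS₁   : ∀ p → toℕ p ≡ 0 → offset start p < sumTo len 1
  prefixS : ℕ → Subset n
  prefixS a = cycInterval start (sumTo len a)

subsets : ∀ n → List (Subset n)
subsets zero    = Data.List.[ Data.Vec.[] ]
subsets (suc n) = map (inside ∷_) (subsets n) ++ map (outside ∷_) (subsets n)

module _ {n} {{_ : NonZero n}} {J : Subset n} (k : ℕ) (D : DOSP J) where
  open DOSP D

  inB : Subset n → Bool
  inB B = (∣ B ∣ ≡ᵇ k) ∧ foldr (λ a b → (sumTo r a ≤ᵇ ∣ B ∩ prefixS a ∣) ∧ b) true (map suc (upTo (ℓ ∸ 1)))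

  -- max_{B ∈ 𝓑} |I ∩ B|   (𝓑 ∋ J is nonempty)
  maxMeet : Subset n → ℕ
  maxMeet I = foldr (λ B m → if inB B then m ⊔ ∣ I ∩ B ∣ else m) 0 (subsets n)

  corank : Subset n → ℕ
  corank I = k ∸ maxMeet I

-- Moves e_I ↦ e_I + e_i - e_{i+1}, staying among 0/1 vectors:
-- requires i ∉ I and i+1 ∈ I.
data Step {n} {{_ : NonZero n}} (I : Subset n) : Subset n → Set where
  move : ∀ i → i ∉ I → next i ∈ I → Step I ((I [ i ]≔ inside) [ next i ]≔ outside)

data Reach {n} {{_ : NonZero n}} : ℕ → Subset n → Subset n → Set where
  here  : ∀ {I} → Reach 0 I I
  there : ∀ {m I K I'} → Step I K → Reach m K I' → Reach (suc m) I I'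

IsDistFrom : ∀ {n} {{_ : NonZero n}} → ℕ → Subset n → (Subset n → ℕ) → Set
IsDistFrom k J d = ∀ I → ∣ I ∣ ≡ k → Reach (d I) J I × (∀ m → Reach m J I → d I ≤ m)

sumOver : ∀ {n} → Subset n → (Fin n → ℚ) → ℚ
sumOver [] x = 0ℚ
sumOver (b ∷ I) x = (if b then x Fin.zero else 0ℚ) +ℚ sumOver I (λ i → x (Fin.suc i))

-- Number the positions 0, …, n-1 going around the circle from the first element of C₁ and let
-- cnt X t = |X ∩ {0, …, t-1}|.  Since cnt J is flat on the gaps C_a and rises with slope one on the
-- runs I_a, the difference cnt J - cnt I peaks at a block end, where the conditions defining 𝓑
-- apply; hence |I ∩ B| + cnt J t ≤ k + cnt I t for B ∈ 𝓑.  Conversely, repeatedly moving the last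
-- element of I into its first gap produces a B ∈ 𝓑 attaining this bound, so
--   corank I = max_t (cnt J t - cnt I t).
-- Moving an element from u+1 back to u inside {0, …, n-1} raises Σ_t cnt I t by one and cannot raise
-- the corank, while moving one from 0 to n-1 lowers Σ_t cnt I t by n-1 and raises the corank by at
-- most one.  So the potential Φ I = Σ_t cnt I t + n · corank I grows by at most one per step, and
-- every I ≠ J has a predecessor exactly one below it: d(e_J, e_I) = Φ I - Φ J.  As corank J = 0 and
-- Σ_t cnt I t = Σ_{p ∈ I} (n-1-p) is linear in I, n 𝔥_J - n corank lies in L_{k,n}.
module Submission where

open import Defs
open import Data.Bool using (Bool; true; false; if_then_else_; _∧_; T)
open import Data.Bool.Properties using (∧-idem; ∧-identityʳ; ∧-zeroʳ; ¬-not) renaming (_≟_ to _≟ᵇ_)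
open import Data.Nat
  using (ℕ; zero; suc; _+_; _*_; _∸_; _≤_; _<_; z≤n; s≤s; s≤s⁻¹; z<s; NonZero; >-nonZero⁻¹; pred; _<ᵇ_; _≡ᵇ_; _⊔_)
open import Data.Nat.Properties
open import Data.Nat.DivMod using (_%_; m%n<n; %-distribˡ-+; m%n%n≡m%n; [m+n]%n≡m%n; m<n⇒m%n≡m; n%n≡0)
open import Data.Nat.Tactic.RingSolver using (solve-∀)
open import Algebra.Properties.CommutativeSemigroup +-commutativeSemigroup
  using (interchange; xy∙z≈xz∙y; xy∙z≈x∙zy; x∙yz≈y∙xz; x∙yz≈zx∙y; x∙yz≈xz∙y)
open import Data.Fin using (Fin; toℕ; fromℕ<) renaming (zero to fzero; suc to fsuc)
open import Data.Fin.Properties using (toℕ<n; toℕ-fromℕ<; toℕ-injective)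
open import Data.Fin.Subset using (Subset; ∣_∣; _∩_; _∈_; _∉_; inside; outside)
open import Data.Vec using ([]; _∷_; tabulate; _[_]≔_; here; there)
open import Data.List using (map; foldr; upTo; _++_) renaming ([] to []ₗ; _∷_ to _∷ₗ_)
open import Data.List.Membership.Propositional using () renaming (_∈_ to _∈ₗ_)
open import Data.List.Membership.Propositional.Properties using (∈-map⁺; ∈-map⁻; ∈-++⁺ˡ; ∈-++⁺ʳ; ∈-upTo⁺; ∈-upTo⁻)
import Data.List.Relation.Unary.Any as Any
open import Data.Product using (Σ; ∃; _×_; _,_; proj₁; proj₂)
open import Data.Sum using (_⊎_; inj₁; inj₂; [_,_]′)
open import Data.Empty using (⊥-elim)
open import Relation.Nullary using (Dec; yes; no)
open import Relation.Binary.Definitions using (tri<; tri≈; tri>)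
open import Function.Bundles using (Equivalence)
open import Relation.Nullary.Decidable using (dec-true; dec-false)
open import Relation.Binary.PropositionalEquality
open import Function using (_∘_; id)

-- Indicator sums over initial segments of ℕ

𝟙 : Bool → ℕ
𝟙 true  = 1
𝟙 false = 0

𝟙≤1 : ∀ b → 𝟙 b ≤ 1
𝟙≤1 true  = ≤-refl
𝟙≤1 false = z≤n

𝟙-injective : ∀ {a b} → 𝟙 a ≡ 𝟙 b → a ≡ b
𝟙-injective {true}  {true}  _ = refl
𝟙-injective {false} {false} _ = refl

𝟙-∧-≤ˡ : ∀ a b → 𝟙 (a ∧ b) ≤ 𝟙 a
𝟙-∧-≤ˡ true  b = 𝟙≤1 b
𝟙-∧-≤ˡ false b = z≤n

𝟙-∧-≤ʳ : ∀ a b → 𝟙 (a ∧ b) ≤ 𝟙 b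
𝟙-∧-≤ʳ true  b = ≤-refl
𝟙-∧-≤ʳ false b = z≤n

<ᵇ-true : ∀ {u t} → u < t → (u <ᵇ t) ≡ true
<ᵇ-true u<t = dec-true (_ <? _) u<t

<ᵇ-false : ∀ {u t} → t ≤ u → (u <ᵇ t) ≡ false
<ᵇ-false t≤u = dec-false (_ <? _) (≤⇒≯ t≤u)

≡ᵇ-refl : ∀ u → (u ≡ᵇ u) ≡ true
≡ᵇ-refl u = dec-true (u ≟ u) refl

≡ᵇ-false : ∀ {u t} → u ≢ t → (u ≡ᵇ t) ≡ false
≡ᵇ-false u≢t = dec-false (_ ≟ _) u≢t

𝟙-<ᵇ-suc : ∀ u t → 𝟙 (u <ᵇ suc t) ≡ 𝟙 (u <ᵇ t) + 𝟙 (t ≡ᵇ u)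
𝟙-<ᵇ-suc zero    zero    = refl
𝟙-<ᵇ-suc zero    (suc t) = refl
𝟙-<ᵇ-suc (suc u) zero    = refl
𝟙-<ᵇ-suc (suc u) (suc t) = 𝟙-<ᵇ-suc u t

𝟙-suc-<ᵇ+≡ᵇ : ∀ u t → 𝟙 (suc u <ᵇ t) + 𝟙 (t ≡ᵇ suc u) ≡ 𝟙 (u <ᵇ t)
𝟙-suc-<ᵇ+≡ᵇ u zero    = refl
𝟙-suc-<ᵇ+≡ᵇ u (suc t) = sym (𝟙-<ᵇ-suc u t)

∑< : ℕ → (ℕ → ℕ) → ℕ
∑< zero    f = 0
∑< (suc t) f = ∑< t f + f t

syntax ∑< t (λ u → e) = ∑[ u < t ] e

∑<-cong : ∀ m {f g : ℕ → ℕ} → (∀ u → u < m → f u ≡ g u) → ∑< m f ≡ ∑< m g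
∑<-cong zero    f≗g = refl
∑<-cong (suc m) f≗g = cong₂ _+_ (∑<-cong m (λ u u<m → f≗g u (m<n⇒m<1+n u<m))) (f≗g m ≤-refl)

∑<-mono : ∀ m {f g : ℕ → ℕ} → (∀ u → u < m → f u ≤ g u) → ∑< m f ≤ ∑< m g
∑<-mono zero    f≤g = z≤n
∑<-mono (suc m) f≤g = +-mono-≤ (∑<-mono m (λ u u<m → f≤g u (m<n⇒m<1+n u<m))) (f≤g m ≤-refl)

∑<-const : ∀ m {f : ℕ → ℕ} c → (∀ u → u < m → f u ≡ c) → ∑< m f ≡ m * c
∑<-const zero    c f≗c = refl
∑<-const (suc m) c f≗c =
  trans (cong₂ _+_ (∑<-const m c (λ u u<m → f≗c u (m<n⇒m<1+n u<m))) (f≗c m ≤-refl)) (+-comm (m * c) c)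

∑<-zero : ∀ m {f : ℕ → ℕ} → (∀ u → u < m → f u ≡ 0) → ∑< m f ≡ 0
∑<-zero m f≗0 = trans (∑<-const m 0 f≗0) (*-zeroʳ m)

∑<-one : ∀ m {f : ℕ → ℕ} → (∀ u → u < m → f u ≡ 1) → ∑< m f ≡ m
∑<-one m f≗1 = trans (∑<-const m 1 f≗1) (*-identityʳ m)

∑<-𝟙≤ : ∀ m (h : ℕ → Bool) → ∑[ u < m ] 𝟙 (h u) ≤ m
∑<-𝟙≤ m h = ≤-trans (∑<-mono m (λ u _ → 𝟙≤1 (h u))) (≤-reflexive (∑<-one m (λ _ _ → refl)))

∑<-+ : ∀ m (f g : ℕ → ℕ) → ∑[ u < m ] (f u + g u) ≡ ∑< m f + ∑< m g
∑<-+ zero    f g = refl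
∑<-+ (suc m) f g = trans (cong (_+ (f m + g m)) (∑<-+ m f g)) (interchange (∑< m f) (∑< m g) (f m) (g m))

∑<-*ˡ : ∀ m c (f : ℕ → ℕ) → ∑[ u < m ] (c * f u) ≡ c * ∑< m f
∑<-*ˡ zero    c f = sym (*-zeroʳ c)
∑<-*ˡ (suc m) c f = trans (cong (_+ c * f m) (∑<-*ˡ m c f)) (sym (*-distribˡ-+ c (∑< m f) (f m)))

∑<-head : ∀ m (f : ℕ → ℕ) → ∑< (suc m) f ≡ f 0 + ∑[ u < m ] f (suc u)
∑<-head zero    f = +-comm 0 (f 0)
∑<-head (suc m) f = trans (cong (_+ f (suc m)) (∑<-head m f)) (+-assoc (f 0) _ _)

∑<-split : ∀ a b (f : ℕ → ℕ) → ∑< (a + b) f ≡ ∑< a f + ∑[ u < b ] f (a + u)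
∑<-split a zero    f = trans (cong (λ x → ∑< x f) (+-identityʳ a)) (sym (+-identityʳ _))
∑<-split a (suc b) f = begin
    ∑< (a + suc b) f                                 ≡⟨ cong (λ x → ∑< x f) (+-suc a b) ⟩
    ∑< (a + b) f + f (a + b)                         ≡⟨ cong (_+ f (a + b)) (∑<-split a b f) ⟩
    ∑< a f + ∑[ u < b ] f (a + u) + f (a + b)        ≡⟨ +-assoc (∑< a f) _ _ ⟩
    ∑< a f + (∑[ u < b ] f (a + u) + f (a + b))      ∎
  where open ≡-Reasoning

∑<-extend : ∀ {t t′} (f : ℕ → ℕ) → t ≤ t′ → ∑< t′ f ≡ ∑< t f + ∑[ v < t′ ∸ t ] f (t + v)
∑<-extend {t} {t′} f t≤t′ = trans (cong (λ x → ∑< x f) (sym (m+[n∸m]≡n t≤t′))) (∑<-split t (t′ ∸ t) f)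

∑<-pointwise : ∀ m (f g : ℕ → ℕ) → (∀ u → u < m → f u ≤ g u) → ∑< m f ≡ ∑< m g → ∀ u → u < m → f u ≡ g u
∑<-pointwise (suc m) f g f≤g sum≡ u u<1+m =
  [ ∑<-pointwise m f g f≤g′ prefix≡ u , (λ { refl → last≡ }) ]′ (m≤n⇒m<n∨m≡n (s≤s⁻¹ u<1+m))
  where
  f≤g′ : ∀ v → v < m → f v ≤ g v
  f≤g′ v v<m = f≤g v (m<n⇒m<1+n v<m)
  prefix≡ : ∑< m f ≡ ∑< m g
  prefix≡ = ≤-antisym (∑<-mono m f≤g′)
    (+-cancelʳ-≤ (f m) _ _ (≤-trans (+-monoʳ-≤ (∑< m g) (f≤g m ≤-refl)) (≤-reflexive (sym sum≡))))
  last≡ : f m ≡ g m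
  last≡ = +-cancelˡ-≡ (∑< m f) _ _ (trans sum≡ (cong (_+ g m) (sym prefix≡)))

∑<-<⇒∃< : ∀ m (f g : ℕ → ℕ) → ∑< m f < ∑< m g → ∃ λ u → u < m × f u < g u
∑<-<⇒∃< (suc m) f g sum< with f m <? g m
... | yes fm<gm = m , ≤-refl , fm<gm
... | no fm≮gm with ∑<-<⇒∃< m f g (+-cancelʳ-< (f m) _ _ (<-≤-trans sum< (+-monoʳ-≤ (∑< m g) (≮⇒≥ fm≮gm))))
...   | u , u<m , fu<gu = u , m<n⇒m<1+n u<m , fu<gu

∑<-≤-except : ∀ m z (f g : ℕ → ℕ) → (∀ u → u < m → u ≢ z → f u ≤ g u) → f z ≤ 1 → ∑< m f ≤ ∑< m g + 1
∑<-≤-except zero    z f g f≤g fz≤1 = z≤n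
∑<-≤-except (suc m) z f g f≤g fz≤1 with m ≟ z
... | yes refl = begin
      ∑< m f + f m        ≤⟨ +-mono-≤ (∑<-mono m (λ u u<m → f≤g u (m<n⇒m<1+n u<m) (<⇒≢ u<m))) fz≤1 ⟩
      ∑< m g + 1          ≤⟨ +-monoˡ-≤ 1 (m≤m+n (∑< m g) (g m)) ⟩
      ∑< m g + g m + 1    ∎
  where open ≤-Reasoning
... | no m≢z = begin
      ∑< m f + f m        ≤⟨ +-mono-≤ (∑<-≤-except m z f g (λ u u<m → f≤g u (m<n⇒m<1+n u<m)) fz≤1) (f≤g m ≤-refl m≢z) ⟩
      ∑< m g + 1 + g m    ≡⟨ xy∙z≈xz∙y (∑< m g) 1 (g m) ⟩
      ∑< m g + g m + 1    ∎
  where open ≤-Reasoning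

∑<-𝟙-<ᵇ : ∀ m a → ∑[ t < m ] 𝟙 (a <ᵇ t) ≡ m ∸ suc a
∑<-𝟙-<ᵇ zero    a = refl
∑<-𝟙-<ᵇ (suc m) a with a <? m
... | yes a<m rewrite ∑<-𝟙-<ᵇ m a | <ᵇ-true a<m = trans (+-comm _ 1) (sym (+-∸-assoc 1 a<m))
... | no a≮m rewrite ∑<-𝟙-<ᵇ m a | <ᵇ-false (≮⇒≥ a≮m) =
  trans (+-identityʳ _) (trans (m≤n⇒m∸n≡0 (m≤n⇒m≤1+n (≮⇒≥ a≮m))) (sym (m≤n⇒m∸n≡0 (≮⇒≥ a≮m))))

∑<-prefixes : ∀ m (f : ℕ → ℕ) → ∑[ t < m ] ∑< t f ≡ ∑[ u < m ] (f u * (m ∸ suc u))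
∑<-prefixes zero    f = refl
∑<-prefixes (suc m) f = begin
    ∑[ t < m ] ∑< t f + ∑< m f
      ≡⟨ cong (_+ ∑< m f) (∑<-prefixes m f) ⟩
    ∑[ u < m ] (f u * (m ∸ suc u)) + ∑< m f
      ≡⟨ sym (∑<-+ m _ f) ⟩
    ∑[ u < m ] (f u * (m ∸ suc u) + f u)
      ≡⟨ ∑<-cong m (λ u u<m → trans (+-comm _ (f u))
        (trans (sym (*-suc (f u) _)) (cong (f u *_) (sym (+-∸-assoc 1 u<m))))) ⟩
    ∑[ u < m ] (f u * (m ∸ u))
      ≡⟨ sym (+-identityʳ _) ⟩
    ∑[ u < m ] (f u * (m ∸ u)) + 0
      ≡⟨ cong (∑[ u < m ] (f u * (m ∸ u)) +_)
        (sym (trans (cong (f m *_) (n∸n≡0 m)) (*-zeroʳ (f m)))) ⟩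
    ∑[ u < m ] (f u * (m ∸ u)) + f m * (m ∸ m) ∎
  where open ≡-Reasoning

∑<-restrict : ∀ m t (h : ℕ → Bool) → t ≤ m → ∑[ u < m ] 𝟙 (h u ∧ (u <ᵇ t)) ≡ ∑[ u < t ] 𝟙 (h u)
∑<-restrict m t h t≤m = begin
    ∑[ u < m ] 𝟙 (h u ∧ (u <ᵇ t))
      ≡⟨ ∑<-extend _ t≤m ⟩
    ∑[ u < t ] 𝟙 (h u ∧ (u <ᵇ t)) + ∑[ v < m ∸ t ] 𝟙 (h (t + v) ∧ (t + v <ᵇ t))
      ≡⟨ cong₂ _+_ (∑<-cong t (λ u u<t → cong (λ b → 𝟙 (h u ∧ b)) (<ᵇ-true u<t)))
                   (∑<-zero (m ∸ t) (λ v _ → cong 𝟙 (trans (cong (h (t + v) ∧_) (<ᵇ-false (m≤m+n t v))) (∧-zeroʳ _)))) ⟩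
    ∑[ u < t ] 𝟙 (h u ∧ true) + 0
      ≡⟨ +-identityʳ _ ⟩
    ∑[ u < t ] 𝟙 (h u ∧ true)
      ≡⟨ ∑<-cong t (λ u _ → cong 𝟙 (∧-identityʳ (h u))) ⟩
    ∑[ u < t ] 𝟙 (h u) ∎
  where open ≡-Reasoning

argmax : (g : ℕ → ℕ) (m : ℕ) → ∃ λ t → t ≤ m × (∀ t′ → t′ ≤ m → g t′ ≤ g t)
argmax g zero    = 0 , z≤n , λ { .0 z≤n → ≤-refl }
argmax g (suc m) with argmax g m
... | t , t≤m , max with g (suc m) ≤? g t
...   | yes last≤ = t , m≤n⇒m≤1+n t≤m , λ t′ t′≤1+m →
  [ (λ t′<1+m → max t′ (s≤s⁻¹ t′<1+m)) , (λ { refl → last≤ }) ]′ (m≤n⇒m<n∨m≡n t′≤1+m)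
...   | no last≰  = suc m , ≤-refl , λ t′ t′≤1+m →
  [ (λ t′<1+m → ≤-trans (max t′ (s≤s⁻¹ t′<1+m)) (<⇒≤ (≰⇒> last≰))) , (λ { refl → ≤-refl }) ]′ (m≤n⇒m<n∨m≡n t′≤1+m)

first-false : (h : ℕ → Bool) (m : ℕ) →
  (∀ v → v < m → h v ≡ true) ⊎ (∃ λ z → z < m × h z ≡ false × (∀ v → v < z → h v ≡ true))
first-false h zero = inj₁ (λ v ())
first-false h (suc m) with first-false h m
... | inj₂ (z , z<m , hz , before) = inj₂ (z , m<n⇒m<1+n z<m , hz , before)
... | inj₁ all with h m in e
...   | false = inj₂ (m , ≤-refl , e , all)
...   | true  = inj₁ λ v v<1+m → [ all v , (λ { refl → e }) ]′ (m≤n⇒m<n∨m≡n (s≤s⁻¹ v<1+m))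

last-true : (h : ℕ → Bool) (m : ℕ) → 0 < ∑[ u < m ] 𝟙 (h u) →
  ∃ λ y → y < m × h y ≡ true × (∀ v → y < v → v < m → h v ≡ false)
last-true h (suc m) pos with h m in e
... | true  = m , ≤-refl , e , λ v m<v v<1+m → ⊥-elim (<⇒≱ m<v (s≤s⁻¹ v<1+m))
... | false with last-true h m (subst (0 <_) (+-identityʳ _) pos)
...   | y , y<m , hy , after =
  y , m<n⇒m<1+n y<m , hy , λ v y<v v<1+m → [ after v y<v , (λ { refl → e }) ]′ (m≤n⇒m<n∨m≡n (s≤s⁻¹ v<1+m))

-- Subsets read position by position

at : ∀ {m} → Subset m → ℕ → Bool
at []      p       = false
at (b ∷ X) zero    = b
at (b ∷ X) (suc p) = at X p

∣∣≡∑<-at : ∀ {m} (X : Subset m) → ∣ X ∣ ≡ ∑[ p < m ] 𝟙 (at X p)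
∣∣≡∑<-at []                = refl
∣∣≡∑<-at {suc m} (true ∷ X)  = trans (cong suc (∣∣≡∑<-at X)) (sym (∑<-head m _))
∣∣≡∑<-at {suc m} (false ∷ X) = trans (∣∣≡∑<-at X) (sym (∑<-head m _))

at-∩ : ∀ {m} (X Y : Subset m) p → at (X ∩ Y) p ≡ (at X p ∧ at Y p)
at-∩ []      []      p       = refl
at-∩ (b ∷ X) (c ∷ Y) zero    = refl
at-∩ (b ∷ X) (c ∷ Y) (suc p) = at-∩ X Y p

at-tabulate : ∀ {m} (g : ℕ → Bool) p → p < m → at (tabulate {n = m} (g ∘ toℕ)) p ≡ g p
at-tabulate {suc m} g zero    _   = refl
at-tabulate {suc m} g (suc p) p<m = at-tabulate {m} (g ∘ suc) p (s≤s⁻¹ p<m)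

at-≔ : ∀ {m} (X : Subset m) i b p → at (X [ i ]≔ b) p ≡ (if p ≡ᵇ toℕ i then b else at X p)
at-≔ (c ∷ X) fzero    b zero    = refl
at-≔ (c ∷ X) fzero    b (suc p) = refl
at-≔ (c ∷ X) (fsuc i) b zero    = refl
at-≔ (c ∷ X) (fsuc i) b (suc p) = at-≔ X i b p

at-ext : ∀ {m} (X Y : Subset m) → (∀ p → p < m → at X p ≡ at Y p) → X ≡ Y
at-ext []      []      _   = refl
at-ext (b ∷ X) (c ∷ Y) X≗Y = cong₂ _∷_ (X≗Y 0 z<s) (at-ext X Y (λ p p<m → X≗Y (suc p) (s≤s p<m)))

∈⇒at : ∀ {m} (X : Subset m) {i} → i ∈ X → at X (toℕ i) ≡ true
∈⇒at (b ∷ X) here      = refl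
∈⇒at (b ∷ X) (there x) = ∈⇒at X x

at⇒∈ : ∀ {m} (X : Subset m) i → at X (toℕ i) ≡ true → i ∈ X
at⇒∈ (true ∷ X) fzero    refl = here
at⇒∈ (b ∷ X)    (fsuc i) e    = there (at⇒∈ X i e)

∉⇒at : ∀ {m} (X : Subset m) i → i ∉ X → at X (toℕ i) ≡ false
∉⇒at X i i∉X with at X (toℕ i) in e
... | true  = ⊥-elim (i∉X (at⇒∈ X i e))
... | false = refl

at⇒∉ : ∀ {m} (X : Subset m) i → at X (toℕ i) ≡ false → i ∉ X
at⇒∉ X i e i∈X with () ← trans (sym (∈⇒at X i∈X)) e

-- Reading the circle from the start of S₁

[m%n+k]%n≡[m+k]%n : ∀ m k n .{{_ : NonZero n}} → (m % n + k) % n ≡ (m + k) % n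
[m%n+k]%n≡[m+k]%n m k n = begin
  (m % n + k) % n            ≡⟨ %-distribˡ-+ (m % n) k n ⟩
  (m % n % n + k % n) % n    ≡⟨ cong (λ x → (x + k % n) % n) (m%n%n≡m%n m n) ⟩
  (m % n + k % n) % n        ≡⟨ sym (%-distribˡ-+ m k n) ⟩
  (m + k) % n                ∎
  where open ≡-Reasoning

-- Position u ∈ {0, …, n-1} is the element rot u of [n]; off inverts rot, and off (toℕ p) is offset start p.
module Rotation (n : ℕ) {{_ : NonZero n}} (start : Fin n) where

  private
    s = toℕ start

    s+[n∸s]≡n : s + (n ∸ s) ≡ n
    s+[n∸s]≡n = m+[n∸m]≡n (<⇒≤ (toℕ<n start))

  rot : ℕ → ℕ
  rot u = (s + u) % n

  off : ℕ → ℕ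
  off p = (p + (n ∸ s)) % n

  rot<n : ∀ u → rot u < n
  rot<n u = m%n<n (s + u) n

  off<n : ∀ p → off p < n
  off<n p = m%n<n (p + (n ∸ s)) n

  off-rot : ∀ {u} → u < n → off (rot u) ≡ u
  off-rot {u} u<n = begin
    ((s + u) % n + (n ∸ s)) % n   ≡⟨ [m%n+k]%n≡[m+k]%n (s + u) (n ∸ s) n ⟩
    (s + u + (n ∸ s)) % n         ≡⟨ cong (_% n) (trans (xy∙z≈xz∙y s u (n ∸ s)) (cong (_+ u) s+[n∸s]≡n)) ⟩
    (n + u) % n                   ≡⟨ cong (_% n) (+-comm n u) ⟩
    (u + n) % n                   ≡⟨ [m+n]%n≡m%n u n ⟩
    u % n                         ≡⟨ m<n⇒m%n≡m u<n ⟩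
    u                             ∎
    where open ≡-Reasoning

  rot-off : ∀ {p} → p < n → rot (off p) ≡ p
  rot-off {p} p<n = begin
    (s + (p + (n ∸ s)) % n) % n
      ≡⟨ cong (_% n) (+-comm s _) ⟩
    ((p + (n ∸ s)) % n + s) % n
      ≡⟨ [m%n+k]%n≡[m+k]%n (p + (n ∸ s)) s n ⟩
    (p + (n ∸ s) + s) % n
      ≡⟨ cong (_% n) (trans (+-assoc p _ _) (cong (p +_) (trans (+-comm (n ∸ s) s) s+[n∸s]≡n))) ⟩
    (p + n) % n
      ≡⟨ [m+n]%n≡m%n p n ⟩
    p % n
      ≡⟨ m<n⇒m%n≡m p<n ⟩
    p ∎
    where open ≡-Reasoning

  rot-injective : ∀ {u v} → u < n → v < n → rot u ≡ rot v → u ≡ v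
  rot-injective u<n v<n eq = trans (sym (off-rot u<n)) (trans (cong off eq) (off-rot v<n))

  ∑<-rot : ∀ (f : ℕ → ℕ) → ∑< n f ≡ ∑[ u < n ] f (rot u)
  ∑<-rot f = begin
    ∑< n f
      ≡⟨ cong (λ x → ∑< x f) (sym s+[n∸s]≡n) ⟩
    ∑< (s + (n ∸ s)) f
      ≡⟨ ∑<-split s (n ∸ s) f ⟩
    ∑< s f + ∑[ u < n ∸ s ] f (s + u)
      ≡⟨ +-comm (∑< s f) _ ⟩
    ∑[ u < n ∸ s ] f (s + u) + ∑< s f
      ≡⟨ cong₂ _+_ (∑<-cong (n ∸ s) tail) (∑<-cong s head) ⟩
    ∑[ u < n ∸ s ] f (rot u) + ∑[ v < s ] f (rot (n ∸ s + v))
      ≡⟨ sym (∑<-split (n ∸ s) s (f ∘ rot)) ⟩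
    ∑< (n ∸ s + s) (f ∘ rot)
      ≡⟨ cong (λ x → ∑< x (f ∘ rot)) (trans (+-comm (n ∸ s) s) s+[n∸s]≡n) ⟩
    ∑[ u < n ] f (rot u) ∎
    where
    open ≡-Reasoning
    tail : ∀ u → u < n ∸ s → f (s + u) ≡ f (rot u)
    tail u u<n∸s = cong f (sym (m<n⇒m%n≡m (subst (s + u <_) s+[n∸s]≡n (+-monoʳ-< s u<n∸s))))
    head : ∀ v → v < s → f v ≡ f (rot (n ∸ s + v))
    head v v<s = cong f (sym (begin
      (s + (n ∸ s + v)) % n   ≡⟨ cong (_% n) (trans (sym (+-assoc s _ v)) (cong (_+ v) s+[n∸s]≡n)) ⟩
      (n + v) % n             ≡⟨ cong (_% n) (+-comm n v) ⟩
      (v + n) % n             ≡⟨ [m+n]%n≡m%n v n ⟩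
      v % n                   ≡⟨ m<n⇒m%n≡m (<-trans v<s (toℕ<n start)) ⟩
      v                       ∎))

  off-next : ∀ (i : Fin n) → off (toℕ (next i)) ≡ suc (off (toℕ i)) % n
  off-next i = begin
    (toℕ (next i) + (n ∸ s)) % n               ≡⟨ cong (λ x → (x + (n ∸ s)) % n) (toℕ-fromℕ< (m%n<n (suc (toℕ i)) n)) ⟩
    (suc (toℕ i) % n + (n ∸ s)) % n            ≡⟨ [m%n+k]%n≡[m+k]%n (suc (toℕ i)) (n ∸ s) n ⟩
    (suc (toℕ i) + (n ∸ s)) % n                ≡⟨ cong (_% n) (+-comm 1 (toℕ i + (n ∸ s))) ⟩
    (toℕ i + (n ∸ s) + 1) % n                  ≡⟨ sym ([m%n+k]%n≡[m+k]%n (toℕ i + (n ∸ s)) 1 n) ⟩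
    ((toℕ i + (n ∸ s)) % n + 1) % n            ≡⟨ cong (_% n) (+-comm _ 1) ⟩
    suc (off (toℕ i)) % n                      ∎
    where open ≡-Reasoning

  at↻ : Subset n → ℕ → Bool
  at↻ X u = at X (rot u)

  cnt : Subset n → ℕ → ℕ
  cnt X t = ∑[ u < t ] 𝟙 (at↻ X u)

  unrot : (ℕ → Bool) → Subset n
  unrot g = tabulate (g ∘ off ∘ toℕ)

  at↻-unrot : ∀ g {u} → u < n → at↻ (unrot g) u ≡ g u
  at↻-unrot g {u} u<n = trans (at-tabulate (g ∘ off) (rot u) (rot<n u)) (cong g (off-rot u<n))

  at↻-ext : ∀ X Y → (∀ u → u < n → at↻ X u ≡ at↻ Y u) → X ≡ Y
  at↻-ext X Y X≗Y = at-ext X Y λ p p<n → subst (λ q → at X q ≡ at Y q) (rot-off p<n) (X≗Y (off p) (off<n p))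

  ∣∣≡cnt : ∀ X → ∣ X ∣ ≡ cnt X n
  ∣∣≡cnt X = trans (∣∣≡∑<-at X) (∑<-rot (𝟙 ∘ at X))

  ∣∩∣≡∑< : ∀ X Y → ∣ X ∩ Y ∣ ≡ ∑[ u < n ] 𝟙 (at↻ X u ∧ at↻ Y u)
  ∣∩∣≡∑< X Y = trans (∣∣≡∑<-at (X ∩ Y)) (trans (∑<-rot _) (∑<-cong n (λ u _ → cong 𝟙 (at-∩ X Y (rot u)))))

  ∣∩cycInterval∣≡cnt : ∀ X {t} → t ≤ n → ∣ X ∩ cycInterval start t ∣ ≡ cnt X t
  ∣∩cycInterval∣≡cnt X {t} t≤n = begin
    ∣ X ∩ cycInterval start t ∣
      ≡⟨ ∣∩∣≡∑< X _ ⟩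
    ∑[ u < n ] 𝟙 (at↻ X u ∧ at↻ (cycInterval start t) u)
      ≡⟨ ∑<-cong n (λ u u<n → cong (λ b → 𝟙 (at↻ X u ∧ b)) (at↻-interval u<n)) ⟩
    ∑[ u < n ] 𝟙 (at↻ X u ∧ (u <ᵇ t))
      ≡⟨ ∑<-restrict n t (at↻ X) t≤n ⟩
    cnt X t ∎
    where
    open ≡-Reasoning
    at↻-interval : ∀ {u} → u < n → at↻ (cycInterval start t) u ≡ (u <ᵇ t)
    at↻-interval {u} u<n = trans (at-tabulate (λ p → off p <ᵇ t) (rot u) (rot<n u)) (cong (_<ᵇ t) (off-rot u<n))

  cnt-extend : ∀ X {t t′} → t ≤ t′ → cnt X t′ ≡ cnt X t + ∑[ v < t′ ∸ t ] 𝟙 (at↻ X (t + v))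
  cnt-extend X = ∑<-extend (𝟙 ∘ at↻ X)

  cnt-mono : ∀ X {t t′} → t ≤ t′ → cnt X t ≤ cnt X t′
  cnt-mono X {t} t≤t′ = subst (cnt X t ≤_) (sym (cnt-extend X t≤t′)) (m≤m+n _ _)

  cnt-≤-+∸ : ∀ X {t t′} → t ≤ t′ → cnt X t′ ≤ cnt X t + (t′ ∸ t)
  cnt-≤-+∸ X {t} {t′} t≤t′ = subst (_≤ cnt X t + (t′ ∸ t)) (sym (cnt-extend X t≤t′)) (+-monoʳ-≤ (cnt X t) (∑<-𝟙≤ (t′ ∸ t) _))

  cnt≤ : ∀ X t → cnt X t ≤ t
  cnt≤ X t = ∑<-𝟙≤ t (at↻ X)

  weight : ℕ → ℕ
  weight p = n ∸ suc (off p)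

  ∑cnt≡weighted : ∀ X → ∑< n (cnt X) ≡ ∑[ p < n ] (𝟙 (at X p) * weight p)
  ∑cnt≡weighted X = begin
    ∑< n (cnt X)
      ≡⟨ ∑<-prefixes n (𝟙 ∘ at↻ X) ⟩
    ∑[ u < n ] (𝟙 (at↻ X u) * (n ∸ suc u))
      ≡⟨ ∑<-cong n (λ u u<n → cong (λ v → 𝟙 (at↻ X u) * (n ∸ suc v)) (sym (off-rot u<n))) ⟩
    ∑[ u < n ] (𝟙 (at X (rot u)) * weight (rot u))
      ≡⟨ sym (∑<-rot (λ p → 𝟙 (at X p) * weight p)) ⟩
    ∑[ p < n ] (𝟙 (at X p) * weight p) ∎
    where open ≡-Reasoning

  pos : ℕ → Fin n
  pos u = fromℕ< (rot<n u)

  toℕ-pos : ∀ u → toℕ (pos u) ≡ rot u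
  toℕ-pos u = toℕ-fromℕ< (rot<n u)

  offset-pos : ∀ {u} → u < n → offset start (pos u) ≡ u
  offset-pos u<n = trans (cong off (toℕ-pos _)) (off-rot u<n)

  exchange : Subset n → ℕ → ℕ → Subset n
  exchange X z y = unrot (λ v → if v ≡ᵇ y then false else if v ≡ᵇ z then true else at↻ X v)

  at↻-exchange : ∀ X z y {v} → v < n →
    at↻ (exchange X z y) v ≡ (if v ≡ᵇ y then false else if v ≡ᵇ z then true else at↻ X v)
  at↻-exchange X z y = at↻-unrot _

  rot-≡ᵇ : ∀ {u v} → u < n → v < n → (rot u ≡ᵇ rot v) ≡ (u ≡ᵇ v)
  rot-≡ᵇ {u} {v} u<n v<n with u ≟ v
  ... | yes refl = trans (≡ᵇ-refl (rot u)) (sym (≡ᵇ-refl u))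
  ... | no u≢v   = trans (≡ᵇ-false (u≢v ∘ rot-injective u<n v<n)) (sym (≡ᵇ-false u≢v))

  step≡exchange : ∀ K (i : Fin n) → (K [ i ]≔ inside) [ next i ]≔ outside ≡ exchange K (off (toℕ i)) (off (toℕ (next i)))
  step≡exchange K i = at↻-ext _ _ λ v v<n → begin
      at ((K [ i ]≔ inside) [ next i ]≔ outside) (rot v)
    ≡⟨ at-≔ (K [ i ]≔ inside) (next i) outside (rot v) ⟩
      (if rot v ≡ᵇ toℕ (next i) then false else at (K [ i ]≔ inside) (rot v))
    ≡⟨ cong (if rot v ≡ᵇ toℕ (next i) then false else_) (at-≔ K i inside (rot v)) ⟩
      (if rot v ≡ᵇ toℕ (next i) then false else if rot v ≡ᵇ toℕ i then true else at↻ K v)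
    ≡⟨ cong₂ (λ a b → if a then false else if b then true else at↻ K v) (≡ᵇ-off v<n (next i)) (≡ᵇ-off v<n i) ⟩
      (if v ≡ᵇ off (toℕ (next i)) then false else if v ≡ᵇ off (toℕ i) then true else at↻ K v)
    ≡⟨ sym (at↻-exchange K _ _ v<n) ⟩
      at↻ (exchange K (off (toℕ i)) (off (toℕ (next i)))) v
    ∎
    where
    open ≡-Reasoning
    ≡ᵇ-off : ∀ {v} → v < n → (j : Fin n) → (rot v ≡ᵇ toℕ j) ≡ (v ≡ᵇ off (toℕ j))
    ≡ᵇ-off v<n j = trans (cong (rot _ ≡ᵇ_) (sym (rot-off (toℕ<n j)))) (rot-≡ᵇ v<n (off<n _))

  module _ (X : Subset n) {z y} (z<n : z < n) (y<n : y < n) (z∉X : at↻ X z ≡ false) (y∈X : at↻ X y ≡ true) where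

    private
      z≢y : z ≢ y
      z≢y refl with () ← trans (sym z∉X) y∈X

      X′ = exchange X z y

    at↻-exchange-y : at↻ X′ y ≡ false
    at↻-exchange-y = trans (at↻-exchange X z y y<n) (cong (if_then false else (if y ≡ᵇ z then true else at↻ X y)) (≡ᵇ-refl y))

    at↻-exchange-z : at↻ X′ z ≡ true
    at↻-exchange-z = trans (at↻-exchange X z y z<n)
      (cong₂ (λ a b → if a then false else if b then true else at↻ X z) (≡ᵇ-false z≢y) (≡ᵇ-refl z))

    at↻-exchange-other : ∀ {v} → v < n → v ≢ y → v ≢ z → at↻ X′ v ≡ at↻ X v
    at↻-exchange-other {v} v<n v≢y v≢z = trans (at↻-exchange X z y v<n)
      (cong₂ (λ a b → if a then false else if b then true else at↻ X v) (≡ᵇ-false v≢y) (≡ᵇ-false v≢z))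

    cnt-exchange : ∀ {t} → t ≤ n → cnt X′ t + 𝟙 (y <ᵇ t) ≡ cnt X t + 𝟙 (z <ᵇ t)
    cnt-exchange {zero}  _     = refl
    cnt-exchange {suc t} t<n = begin
      cnt X′ t + 𝟙 (at↻ X′ t) + 𝟙 (y <ᵇ suc t)
        ≡⟨ cong (cnt X′ t + 𝟙 (at↻ X′ t) +_) (𝟙-<ᵇ-suc y t) ⟩
      cnt X′ t + 𝟙 (at↻ X′ t) + (𝟙 (y <ᵇ t) + 𝟙 (t ≡ᵇ y))
        ≡⟨ interchange (cnt X′ t) _ _ _ ⟩
      cnt X′ t + 𝟙 (y <ᵇ t) + (𝟙 (at↻ X′ t) + 𝟙 (t ≡ᵇ y))
        ≡⟨ cong₂ _+_ (cnt-exchange (<⇒≤ t<n)) (local t<n) ⟩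
      cnt X t + 𝟙 (z <ᵇ t) + (𝟙 (at↻ X t) + 𝟙 (t ≡ᵇ z))
        ≡⟨ interchange (cnt X t) _ _ _ ⟩
      cnt X t + 𝟙 (at↻ X t) + (𝟙 (z <ᵇ t) + 𝟙 (t ≡ᵇ z))
        ≡⟨ cong (cnt X t + 𝟙 (at↻ X t) +_) (sym (𝟙-<ᵇ-suc z t)) ⟩
      cnt X t + 𝟙 (at↻ X t) + 𝟙 (z <ᵇ suc t) ∎
      where
      open ≡-Reasoning
      local : ∀ {t} → t < n → 𝟙 (at↻ X′ t) + 𝟙 (t ≡ᵇ y) ≡ 𝟙 (at↻ X t) + 𝟙 (t ≡ᵇ z)
      local {t} t<n with t ≟ y | t ≟ z
      ... | yes refl | _        rewrite at↻-exchange-y | y∈X | ≡ᵇ-refl t | ≡ᵇ-false (z≢y ∘ sym) = refl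
      ... | no t≢y   | yes refl rewrite at↻-exchange-z | z∉X | ≡ᵇ-refl t | ≡ᵇ-false t≢y = refl
      ... | no t≢y   | no t≢z   rewrite at↻-exchange-other t<n t≢y t≢z | ≡ᵇ-false t≢y | ≡ᵇ-false t≢z = refl

    cnt-n-exchange : cnt X′ n ≡ cnt X n
    cnt-n-exchange = +-cancelʳ-≡ 1 _ _
      (subst₂ (λ a b → cnt X′ n + 𝟙 a ≡ cnt X n + 𝟙 b) (<ᵇ-true y<n) (<ᵇ-true z<n) (cnt-exchange ≤-refl))

    ∣exchange∩∣≤ : ∀ B → ∣ X′ ∩ B ∣ ≤ ∣ X ∩ B ∣ + 1
    ∣exchange∩∣≤ B = subst₂ _≤_ (sym (∣∩∣≡∑< X′ B)) (cong (_+ 1) (sym (∣∩∣≡∑< X B)))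
      (∑<-≤-except n z _ _ le (𝟙≤1 _))
      where
      le : ∀ u → u < n → u ≢ z → 𝟙 (at↻ X′ u ∧ at↻ B u) ≤ 𝟙 (at↻ X u ∧ at↻ B u)
      le u u<n u≢z with u ≟ y
      ... | yes refl rewrite at↻-exchange-y = z≤n
      ... | no u≢y   rewrite at↻-exchange-other u<n u≢y u≢z = ≤-refl

    ∑cnt-exchange : ∑< n (cnt X′) + (n ∸ suc y) ≡ ∑< n (cnt X) + (n ∸ suc z)
    ∑cnt-exchange = begin
      ∑< n (cnt X′) + (n ∸ suc y)                     ≡⟨ cong (∑< n (cnt X′) +_) (sym (∑<-𝟙-<ᵇ n y)) ⟩
      ∑< n (cnt X′) + ∑[ t < n ] 𝟙 (y <ᵇ t)           ≡⟨ sym (∑<-+ n (cnt X′) _) ⟩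
      ∑[ t < n ] (cnt X′ t + 𝟙 (y <ᵇ t))              ≡⟨ ∑<-cong n (λ t t<n → cnt-exchange (<⇒≤ t<n)) ⟩
      ∑[ t < n ] (cnt X t + 𝟙 (z <ᵇ t))               ≡⟨ ∑<-+ n (cnt X) _ ⟩
      ∑< n (cnt X) + ∑[ t < n ] 𝟙 (z <ᵇ t)            ≡⟨ cong (∑< n (cnt X) +_) (∑<-𝟙-<ᵇ n z) ⟩
      ∑< n (cnt X) + (n ∸ suc z)                      ∎
      where open ≡-Reasoning

    exchange-exchange : exchange X′ y z ≡ X
    exchange-exchange = at↻-ext _ _ λ v v<n → trans (at↻-exchange X′ y z v<n) (undo v<n)
      where
      undo : ∀ {v} → v < n → (if v ≡ᵇ z then false else if v ≡ᵇ y then true else at↻ X′ v) ≡ at↻ X v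
      undo {v} v<n with v ≟ z | v ≟ y
      ... | yes refl | _        rewrite ≡ᵇ-refl v = sym z∉X
      ... | no v≢z   | yes refl rewrite ≡ᵇ-false v≢z | ≡ᵇ-refl v = sym y∈X
      ... | no v≢z   | no v≢y   rewrite ≡ᵇ-false v≢z | ≡ᵇ-false v≢y = at↻-exchange-other v<n v≢y v≢z

  module _ (K : Subset n) {u} (u+1<n : suc u < n) (u∉K : at↻ K u ≡ false) (u+1∈K : at↻ K (suc u) ≡ true) where

    cnt-shift : ∀ {t} → t ≤ n → cnt (exchange K u (suc u)) t ≡ cnt K t + 𝟙 (t ≡ᵇ suc u)
    cnt-shift {t} t≤n = +-cancelʳ-≡ (𝟙 (suc u <ᵇ t)) _ _ (begin
      cnt (exchange K u (suc u)) t + 𝟙 (suc u <ᵇ t)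
        ≡⟨ cnt-exchange K (<-trans (n<1+n u) u+1<n) u+1<n u∉K u+1∈K t≤n ⟩
      cnt K t + 𝟙 (u <ᵇ t)
        ≡⟨ cong (cnt K t +_) (sym (𝟙-suc-<ᵇ+≡ᵇ u t)) ⟩
      cnt K t + (𝟙 (suc u <ᵇ t) + 𝟙 (t ≡ᵇ suc u))
        ≡⟨ x∙yz≈xz∙y (cnt K t) _ _ ⟩
      cnt K t + 𝟙 (t ≡ᵇ suc u) + 𝟙 (suc u <ᵇ t) ∎)
      where open ≡-Reasoning

    ∑cnt-shift : ∑< n (cnt (exchange K u (suc u))) ≡ suc (∑< n (cnt K))
    ∑cnt-shift = +-cancelʳ-≡ (n ∸ suc (suc u)) _ _ (begin
      ∑< n (cnt (exchange K u (suc u))) + (n ∸ suc (suc u))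
        ≡⟨ ∑cnt-exchange K (<-trans (n<1+n u) u+1<n) u+1<n u∉K u+1∈K ⟩
      ∑< n (cnt K) + (n ∸ suc u)
        ≡⟨ cong (∑< n (cnt K) +_) (+-∸-assoc 1 u+1<n) ⟩
      ∑< n (cnt K) + suc (n ∸ suc (suc u))
        ≡⟨ +-suc _ _ ⟩
      suc (∑< n (cnt K)) + (n ∸ suc (suc u)) ∎)
      where open ≡-Reasoning

  module _ (K : Subset n) {u} (u+1≡n : suc u ≡ n) (u∉K : at↻ K u ≡ false) (0∈K : at↻ K 0 ≡ true) where

    private
      u<n = subst (u <_) u+1≡n (n<1+n u)
      K′ = exchange K u 0

    cnt-wrap : ∀ {t} → 0 < t → t < n → cnt K′ t + 1 ≡ cnt K t
    cnt-wrap {t} 0<t t<n = trans (subst₂ (λ a b → cnt K′ t + 𝟙 a ≡ cnt K t + 𝟙 b) (<ᵇ-true 0<t) (<ᵇ-false t≤u)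
      (cnt-exchange K u<n (>-nonZero⁻¹ n) u∉K 0∈K (<⇒≤ t<n))) (+-identityʳ _)
      where
      t≤u : t ≤ u
      t≤u = s≤s⁻¹ (subst (t <_) (sym u+1≡n) t<n)

    cnt-wrap-≤ : ∀ {t} → t ≤ n → cnt K t ≤ cnt K′ t + 1
    cnt-wrap-≤ {t} t≤n = begin
      cnt K t                   ≤⟨ m≤m+n _ _ ⟩
      cnt K t + 𝟙 (u <ᵇ t)      ≡⟨ sym (cnt-exchange K u<n (>-nonZero⁻¹ n) u∉K 0∈K t≤n) ⟩
      cnt K′ t + 𝟙 (0 <ᵇ t)     ≤⟨ +-monoʳ-≤ (cnt K′ t) (𝟙≤1 _) ⟩
      cnt K′ t + 1              ∎
      where open ≤-Reasoning

    ∑cnt-wrap : ∑< n (cnt K′) + u ≡ ∑< n (cnt K)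
    ∑cnt-wrap = begin
      ∑< n (cnt K′) + u              ≡⟨ cong (λ m → ∑< n (cnt K′) + (m ∸ 1)) u+1≡n ⟩
      ∑< n (cnt K′) + (n ∸ 1)        ≡⟨ ∑cnt-exchange K u<n (>-nonZero⁻¹ n) u∉K 0∈K ⟩
      ∑< n (cnt K) + (n ∸ suc u)     ≡⟨ cong (λ m → ∑< n (cnt K) + (n ∸ m)) u+1≡n ⟩
      ∑< n (cnt K) + (n ∸ n)         ≡⟨ cong (∑< n (cnt K) +_) (n∸n≡0 n) ⟩
      ∑< n (cnt K) + 0               ≡⟨ +-identityʳ _ ⟩
      ∑< n (cnt K)                   ∎
      where open ≡-Reasoning

  off-next-pos : ∀ {u} → u < n → off (toℕ (next (pos u))) ≡ suc u % n
  off-next-pos u<n = trans (off-next (pos _)) (cong (λ x → suc x % n) (offset-pos u<n))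

  step⇒exchange : ∀ {K K′} → Step K K′ →
    ∃ λ u → u < n × at↻ K u ≡ false × at↻ K (suc u % n) ≡ true × K′ ≡ exchange K u (suc u % n)
  step⇒exchange {K} (move i i∉K next∈K) =
    off (toℕ i) , off<n _ ,
    trans (cong (at K) (rot-off (toℕ<n i))) (∉⇒at K i i∉K) ,
    subst (λ x → at↻ K x ≡ true) (off-next i) (trans (cong (at K) (rot-off (toℕ<n (next i)))) (∈⇒at K next∈K)) ,
    trans (step≡exchange K i) (cong (exchange K _) (off-next i))

  exchange⇒step : ∀ I {u} → u < n → at↻ I u ≡ true → at↻ I (suc u % n) ≡ false → Step (exchange I (suc u % n) u) I
  exchange⇒step I {u} u<n u∈I u+1∉I = subst (Step K) K→I
      (move (pos u) (at⇒∉ K (pos u) (trans (cong (at K) (toℕ-pos u)) (at↻-exchange-y I u+1<n u<n u+1∉I u∈I)))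
                    (at⇒∈ K (next (pos u)) (trans (cong (at K) (sym (rot-off (toℕ<n (next (pos u))))))
                      (trans (cong (at↻ K) (off-next-pos u<n)) (at↻-exchange-z I u+1<n u<n u+1∉I u∈I)))))
    where
    u+1<n = m%n<n (suc u) n
    K = exchange I (suc u % n) u
    K→I : (K [ pos u ]≔ inside) [ next (pos u) ]≔ outside ≡ I
    K→I = trans (step≡exchange K (pos u))
      (trans (cong₂ (exchange K) (offset-pos u<n) (off-next-pos u<n)) (exchange-exchange I u+1<n u<n u+1∉I u∈I))

-- The runs of J

sumTo-zero : ∀ {ℓ} (f : Fin ℓ → ℕ) → sumTo f 0 ≡ 0
sumTo-zero {zero}  f = refl
sumTo-zero {suc ℓ} f = refl

sumTo-suc : ∀ {ℓ} (f : Fin ℓ → ℕ) (b : Fin ℓ) → sumTo f (suc (toℕ b)) ≡ sumTo f (toℕ b) + f b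
sumTo-suc {suc ℓ} f fzero    = trans (cong (f fzero +_) (sumTo-zero (f ∘ fsuc))) (+-comm (f fzero) 0)
sumTo-suc {suc ℓ} f (fsuc b) = trans (cong (f fzero +_) (sumTo-suc (f ∘ fsuc) b)) (sym (+-assoc (f fzero) _ _))

sumTo-mono : ∀ {ℓ} (f : Fin ℓ → ℕ) {a b} → a ≤ b → sumTo f a ≤ sumTo f b
sumTo-mono {zero}  f _ = z≤n
sumTo-mono {suc ℓ} f {zero}  _ = z≤n
sumTo-mono {suc ℓ} f {suc a} {suc b} (s≤s a≤b) = +-monoʳ-≤ (f fzero) (sumTo-mono (f ∘ fsuc) a≤b)

sumTo-block : ∀ {ℓ} (f : Fin ℓ → ℕ) {t} → t < sumTo f ℓ →
  ∃ λ (b : Fin ℓ) → sumTo f (toℕ b) ≤ t × t < sumTo f (suc (toℕ b))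
sumTo-block {suc ℓ} f {t} t<total with t <? f fzero
... | yes t<f0 = fzero , z≤n , subst (t <_) (sym (sumTo-suc f fzero)) t<f0
... | no t≮f0 with sumTo-block (f ∘ fsuc) {t ∸ f fzero}
                     (+-cancelˡ-< (f fzero) _ _ (subst (_< f fzero + _) (sym (m+[n∸m]≡n (≮⇒≥ t≮f0))) t<total))
...   | b , lo , hi = fsuc b ,
  subst (f fzero + sumTo (f ∘ fsuc) (toℕ b) ≤_) (m+[n∸m]≡n (≮⇒≥ t≮f0)) (+-monoʳ-≤ (f fzero) lo) ,
  subst (_< f fzero + sumTo (f ∘ fsuc) (suc (toℕ b))) (m+[n∸m]≡n (≮⇒≥ t≮f0)) (+-monoʳ-< (f fzero) hi)

module Runs {n} {{_ : NonZero n}} {J : Subset n} (D : DOSP J) where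

  open DOSP D
  open Rotation n start

  blockEnd : ℕ → ℕ
  blockEnd = sumTo len

  private
    blockEnd-suc : ∀ b → blockEnd (suc (toℕ b)) ≡ blockEnd (toℕ b) + c b + r b
    blockEnd-suc b = trans (sumTo-suc len b) (sym (+-assoc _ (c b) (r b)))

    gapEnd≤blockEnd : ∀ b → blockEnd (toℕ b) + c b ≤ blockEnd (suc (toℕ b))
    gapEnd≤blockEnd b = subst (blockEnd (toℕ b) + c b ≤_) (sym (blockEnd-suc b)) (m≤m+n _ (r b))

  blockEnd-mono : ∀ {a b} → a ≤ b → blockEnd a ≤ blockEnd b
  blockEnd-mono = sumTo-mono len

  blockEnd≤n : ∀ {a} → a ≤ ℓ → blockEnd a ≤ n
  blockEnd≤n a≤ℓ = subst (blockEnd _ ≤_) total (blockEnd-mono a≤ℓ)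

  private
    blockEnd<n : ∀ {b} {u} → u < blockEnd (suc (toℕ b)) → u < n
    blockEnd<n {b} u< = <-≤-trans u< (blockEnd≤n (toℕ<n b))

  at↻J⇒InRun : ∀ {u} → u < n → at↻ J u ≡ true → InRun u
  at↻J⇒InRun {u} u<n u∈J = subst InRun (offset-pos u<n)
    (Equivalence.to (members (pos u)) (at⇒∈ J (pos u) (trans (cong (at J) (toℕ-pos u)) u∈J)))

  InRun⇒at↻J : ∀ {u} → u < n → InRun u → at↻ J u ≡ true
  InRun⇒at↻J {u} u<n run = trans (cong (at J) (sym (toℕ-pos u)))
    (∈⇒at J (Equivalence.from (members (pos u)) (subst InRun (sym (offset-pos u<n)) run)))

  at↻J-gap : ∀ b {u} → blockEnd (toℕ b) ≤ u → u < blockEnd (toℕ b) + c b → at↻ J u ≡ false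
  at↻J-gap b {u} lo hi with at↻ J u in u∈J
  ... | false = refl
  ... | true with at↻J⇒InRun (blockEnd<n {b} (<-≤-trans hi (gapEnd≤blockEnd b))) u∈J
  ...   | b′ , lo′ , hi′ with <-cmp (toℕ b′) (toℕ b)
  ...     | tri< b′<b _ _ = ⊥-elim (<⇒≱ hi′ (≤-trans (blockEnd-mono b′<b) lo))
  ...     | tri≈ _ b′≡b _ = ⊥-elim (<⇒≱ hi (subst (λ x → blockEnd (toℕ x) + c x ≤ u) (toℕ-injective b′≡b) lo′))
  ...     | tri> _ _ b<b′ = ⊥-elim (<⇒≱ hi (≤-trans (gapEnd≤blockEnd b) (≤-trans (blockEnd-mono b<b′) (m+n≤o⇒m≤o _ lo′))))

  at↻J-run : ∀ b {u} → blockEnd (toℕ b) + c b ≤ u → u < blockEnd (suc (toℕ b)) → at↻ J u ≡ true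
  at↻J-run b lo hi = InRun⇒at↻J (blockEnd<n {b} hi) (b , lo , hi)

  at↻J-0 : at↻ J 0 ≡ false
  at↻J-0 with at↻ J 0 in 0∈J
  ... | false = refl
  ... | true with at↻J⇒InRun (>-nonZero⁻¹ n) 0∈J
  ...   | b , lo , _ = ⊥-elim (<⇒≱ (≤-trans (c-pos b) (m≤n+m (c b) _)) lo)

  cntJ< : ∀ {t} → 0 < t → cnt J t < t
  cntJ< {suc t} _ = begin-strict
    cnt J (suc t)       ≤⟨ cnt-≤-+∸ J (s≤s (z≤n {t})) ⟩
    cnt J 1 + t         ≡⟨ cong (λ b → 𝟙 b + t) at↻J-0 ⟩
    t                   <⟨ n<1+n t ⟩
    suc t               ∎
    where open ≤-Reasoning

  cntJ-gap : ∀ b {t} → blockEnd (toℕ b) ≤ t → t ≤ blockEnd (toℕ b) + c b → cnt J t ≡ cnt J (blockEnd (toℕ b))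
  cntJ-gap b {t} lo hi = trans (cnt-extend J lo) (trans (cong (cnt J (blockEnd (toℕ b)) +_) (∑<-zero _ outside-J)) (+-identityʳ _))
    where
    outside-J : ∀ v → v < t ∸ blockEnd (toℕ b) → 𝟙 (at↻ J (blockEnd (toℕ b) + v)) ≡ 0
    outside-J v v<t∸e = cong 𝟙 (at↻J-gap b (m≤m+n _ v)
      (+-monoʳ-< _ (<-≤-trans v<t∸e (≤-trans (∸-monoˡ-≤ (blockEnd (toℕ b)) hi) (≤-reflexive (m+n∸m≡n (blockEnd (toℕ b)) (c b)))))))

  cntJ-run : ∀ b {t} → blockEnd (toℕ b) + c b ≤ t → t ≤ blockEnd (suc (toℕ b)) →
    cnt J (blockEnd (suc (toℕ b))) ≡ cnt J t + (blockEnd (suc (toℕ b)) ∸ t)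
  cntJ-run b {t} lo hi = trans (cnt-extend J hi) (cong (cnt J t +_) (∑<-one _ λ v v< →
    cong 𝟙 (at↻J-run b (≤-trans lo (m≤m+n t v)) (subst (t + v <_) (m+[n∸m]≡n hi) (+-monoʳ-< t v<)))))

  cntJ-block : ∀ b → cnt J (blockEnd (suc (toℕ b))) ≡ cnt J (blockEnd (toℕ b)) + r b
  cntJ-block b = begin
    cnt J (blockEnd (suc (toℕ b)))
      ≡⟨ cntJ-run b ≤-refl (gapEnd≤blockEnd b) ⟩
    cnt J (blockEnd (toℕ b) + c b) + (blockEnd (suc (toℕ b)) ∸ (blockEnd (toℕ b) + c b))
      ≡⟨ cong₂ _+_ (cntJ-gap b (m≤m+n _ _) ≤-refl)
                   (trans (cong (_∸ (blockEnd (toℕ b) + c b)) (blockEnd-suc b)) (m+n∸m≡n (blockEnd (toℕ b) + c b) (r b))) ⟩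
    cnt J (blockEnd (toℕ b)) + r b ∎
    where open ≡-Reasoning

  cntJ-blockEnd : ∀ {a} → a ≤ ℓ → cnt J (blockEnd a) ≡ sumTo r a
  cntJ-blockEnd {zero}  _   = trans (cong (cnt J) (sumTo-zero len)) (sym (sumTo-zero r))
  cntJ-blockEnd {suc a} a<ℓ = begin
    cnt J (blockEnd (suc a))
      ≡⟨ cong (λ x → cnt J (blockEnd (suc x))) (sym (toℕ-fromℕ< a<ℓ)) ⟩
    cnt J (blockEnd (suc (toℕ b)))
      ≡⟨ cntJ-block b ⟩
    cnt J (blockEnd (toℕ b)) + r b
      ≡⟨ cong (_+ r b) (trans (cong (cnt J ∘ blockEnd) (toℕ-fromℕ< a<ℓ)) (cntJ-blockEnd (<⇒≤ a<ℓ))) ⟩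
    sumTo r a + r b
      ≡⟨ cong (λ x → sumTo r x + r b) (sym (toℕ-fromℕ< a<ℓ)) ⟩
    sumTo r (toℕ b) + r b
      ≡⟨ sym (sumTo-suc r b) ⟩
    sumTo r (suc (toℕ b))
      ≡⟨ cong (sumTo r ∘ suc) (toℕ-fromℕ< a<ℓ) ⟩
    sumTo r (suc a) ∎
    where
    open ≡-Reasoning
    b = fromℕ< a<ℓ

  blockEnd-extremal : ∀ X {t} → t ≤ n → ∃ λ a → a ≤ ℓ × cnt X (blockEnd a) + cnt J t ≤ cnt X t + cnt J (blockEnd a)
  blockEnd-extremal X {t} t≤n with m≤n⇒m<n∨m≡n t≤n
  ... | inj₂ refl = ℓ , ≤-refl , ≤-reflexive (cong₂ _+_ (cong (cnt X) total) (cong (cnt J) (sym total)))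
  ... | inj₁ t<n with sumTo-block len (subst (t <_) (sym total) t<n)
  ...   | b , lo , hi with t ≤? blockEnd (toℕ b) + c b
  ...     | yes inGap = toℕ b , <⇒≤ (toℕ<n b) , +-mono-≤ (cnt-mono X lo) (≤-reflexive (cntJ-gap b lo inGap))
  ...     | no inRun = suc (toℕ b) , toℕ<n b , (begin
    cnt X (blockEnd (suc (toℕ b))) + cnt J t                    ≤⟨ +-monoˡ-≤ (cnt J t) (cnt-≤-+∸ X (<⇒≤ hi)) ⟩
    cnt X t + (blockEnd (suc (toℕ b)) ∸ t) + cnt J t            ≡⟨ +-assoc (cnt X t) _ _ ⟩
    cnt X t + ((blockEnd (suc (toℕ b)) ∸ t) + cnt J t)          ≡⟨ cong (cnt X t +_) (trans (+-comm _ (cnt J t))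
                                                                     (sym (cntJ-run b (<⇒≤ (≰⇒> inRun)) (<⇒≤ hi)))) ⟩
    cnt X t + cnt J (blockEnd (suc (toℕ b)))                    ∎)
    where open ≤-Reasoning

-- The corank as the largest deficit of I against J

∧-true : ∀ {a b} → (a ∧ b) ≡ true → a ≡ true × b ≡ true
∧-true {true} {true} _ = refl , refl

foldr-∧-true⇒ : ∀ {A : Set} (p : A → Bool) xs →
  foldr (λ a b → p a ∧ b) true xs ≡ true → ∀ {a} → a ∈ₗ xs → p a ≡ true
foldr-∧-true⇒ p (x ∷ₗ xs) all (Any.here refl) = proj₁ (∧-true all)
foldr-∧-true⇒ p (x ∷ₗ xs) all (Any.there a∈xs) = foldr-∧-true⇒ p xs (proj₂ (∧-true {p x} all)) a∈xs

foldr-∧-true⇐ : ∀ {A : Set} (p : A → Bool) xs →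
  (∀ {a} → a ∈ₗ xs → p a ≡ true) → foldr (λ a b → p a ∧ b) true xs ≡ true
foldr-∧-true⇐ p []ₗ        all = refl
foldr-∧-true⇐ p (x ∷ₗ xs) all rewrite all (Any.here refl) = foldr-∧-true⇐ p xs (all ∘ Any.there)

∈-innerIndices⇒ : ∀ ℓ {a} → a ∈ₗ map suc (upTo (ℓ ∸ 1)) → 1 ≤ a × a < ℓ
∈-innerIndices⇒ (suc ℓ) a∈ with ∈-map⁻ suc a∈
... | x , x∈ , refl = s≤s z≤n , s≤s (∈-upTo⁻ x∈)

∈-innerIndices⇐ : ∀ ℓ {a} → 1 ≤ a → a < ℓ → a ∈ₗ map suc (upTo (ℓ ∸ 1))
∈-innerIndices⇐ (suc ℓ) {suc a} _ (s≤s a<ℓ) = ∈-map⁺ suc (∈-upTo⁺ a<ℓ)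

∈-subsets : ∀ m (B : Subset m) → B ∈ₗ subsets m
∈-subsets zero    []          = Any.here refl
∈-subsets (suc m) (true ∷ B)  = ∈-++⁺ˡ (∈-map⁺ (inside ∷_) (∈-subsets m B))
∈-subsets (suc m) (false ∷ B) = ∈-++⁺ʳ (map (inside ∷_) (subsets m)) (∈-map⁺ (outside ∷_) (∈-subsets m B))

module Corank {n} {{_ : NonZero n}} {J : Subset n} (k : ℕ) (D : DOSP J) (∣J∣≡k : ∣ J ∣ ≡ k) (0<k : 0 < k) (k<n : k < n) where

  open DOSP D
  open Rotation n start
  open Runs D

  cntJ-n : cnt J n ≡ k
  cntJ-n = trans (sym (∣∣≡cnt J)) ∣J∣≡k

  cntJ≤k : ∀ {t} → t ≤ n → cnt J t ≤ k
  cntJ≤k t≤n = subst (_ ≤_) cntJ-n (cnt-mono J t≤n)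

  ∣∩prefixS∣≡cnt : ∀ X {a} → a ≤ ℓ → ∣ X ∩ prefixS a ∣ ≡ cnt X (blockEnd a)
  ∣∩prefixS∣≡cnt X a≤ℓ = ∣∩cycInterval∣≡cnt X (blockEnd≤n a≤ℓ)

  inB⇒ : ∀ B → inB k D B ≡ true → cnt B n ≡ k × (∀ {a} → a ≤ ℓ → cnt J (blockEnd a) ≤ cnt B (blockEnd a))
  inB⇒ B B∈𝓑 = ∣B∣≡k , dominates
    where
    size-ok = proj₁ (∧-true B∈𝓑)
    prefixes-ok = proj₂ (∧-true {∣ B ∣ ≡ᵇ k} B∈𝓑)
    ∣B∣≡k : cnt B n ≡ k
    ∣B∣≡k = trans (sym (∣∣≡cnt B)) (≡ᵇ⇒≡ _ _ (subst T (sym size-ok) _))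
    dominates : ∀ {a} → a ≤ ℓ → cnt J (blockEnd a) ≤ cnt B (blockEnd a)
    dominates {a} a≤ℓ with a ≟ 0 | a ≟ ℓ
    ... | yes refl | _        = ≤-reflexive (trans (cong (cnt J) (sumTo-zero len)) (sym (cong (cnt B) (sumTo-zero len))))
    ... | no _     | yes refl = ≤-reflexive (trans (trans (cong (cnt J) total) cntJ-n) (sym (trans (cong (cnt B) total) ∣B∣≡k)))
    ... | no a≢0   | no a≢ℓ   = subst₂ _≤_ (sym (cntJ-blockEnd a≤ℓ)) (∣∩prefixS∣≡cnt B a≤ℓ)
      (≤ᵇ⇒≤ _ _ (subst T (sym (foldr-∧-true⇒ _ _ prefixes-ok (∈-innerIndices⇐ ℓ (n≢0⇒n>0 a≢0) (≤∧≢⇒< a≤ℓ a≢ℓ)))) _))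

  inB⇐ : ∀ B → cnt B n ≡ k → (∀ {t} → t ≤ n → cnt J t ≤ cnt B t) → inB k D B ≡ true
  inB⇐ B ∣B∣≡k dominates = cong₂ _∧_ size-ok prefixes-ok
    where
    size-ok : (∣ B ∣ ≡ᵇ k) ≡ true
    size-ok = subst (λ x → (x ≡ᵇ k) ≡ true) (sym (trans (∣∣≡cnt B) ∣B∣≡k)) (≡ᵇ-refl k)
    prefixes-ok = foldr-∧-true⇐ _ _ λ a∈ →
      let a≤ℓ = <⇒≤ (proj₂ (∈-innerIndices⇒ ℓ a∈)) in
      dec-true (_ ≤? _) (subst₂ _≤_ (cntJ-blockEnd a≤ℓ) (sym (∣∩prefixS∣≡cnt B a≤ℓ)) (dominates (blockEnd≤n a≤ℓ)))

  module _ (I : Subset n) where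

    private
      step : Subset n → ℕ → ℕ
      step B m = if inB k D B then m ⊔ ∣ I ∩ B ∣ else m

    maxMeet-lub : ∀ {v} → (∀ B → inB k D B ≡ true → ∣ I ∩ B ∣ ≤ v) → maxMeet k D I ≤ v
    maxMeet-lub {v} bound = go (subsets n)
      where
      go : ∀ Bs → foldr step 0 Bs ≤ v
      go []ₗ = z≤n
      go (B ∷ₗ Bs) with inB k D B in B∈𝓑
      ... | true  = ⊔-lub (go Bs) (bound B B∈𝓑)
      ... | false = go Bs

    maxMeet-≥ : ∀ B → inB k D B ≡ true → ∣ I ∩ B ∣ ≤ maxMeet k D I
    maxMeet-≥ B B∈𝓑 = go (subsets n) (∈-subsets n B)
      where
      go : ∀ Bs → B ∈ₗ Bs → ∣ I ∩ B ∣ ≤ foldr step 0 Bs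
      go (B ∷ₗ Bs) (Any.here refl) rewrite B∈𝓑 = m≤n⊔m _ _
      go (B′ ∷ₗ Bs) (Any.there B∈Bs) with inB k D B′
      ... | true  = ≤-trans (go Bs B∈Bs) (m≤m⊔n _ _)
      ... | false = go Bs B∈Bs

  ∣∩∣+cnt≤ : ∀ X B {t} → t ≤ n → ∣ X ∩ B ∣ + cnt B t ≤ cnt X t + cnt B n
  ∣∩∣+cnt≤ X B {t} t≤n = begin
    ∣ X ∩ B ∣ + cnt B t
      ≡⟨ cong (_+ cnt B t) (trans (∣∩∣≡∑< X B) (∑<-extend both t≤n)) ⟩
    ∑< t both + ∑[ v < n ∸ t ] both (t + v) + cnt B t
      ≤⟨ +-monoˡ-≤ (cnt B t) (+-mono-≤
        (∑<-mono t (λ u _ → 𝟙-∧-≤ˡ (at↻ X u) (at↻ B u)))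
        (∑<-mono (n ∸ t) (λ v _ → 𝟙-∧-≤ʳ (at↻ X (t + v)) (at↻ B (t + v))))) ⟩
    cnt X t + ∑[ v < n ∸ t ] 𝟙 (at↻ B (t + v)) + cnt B t
      ≡⟨ trans (+-assoc (cnt X t) _ _)
        (cong (cnt X t +_) (trans (+-comm _ (cnt B t)) (sym (cnt-extend B t≤n)))) ⟩
    cnt X t + cnt B n ∎
    where
    open ≤-Reasoning
    both : ℕ → ℕ
    both u = 𝟙 (at↻ X u ∧ at↻ B u)

  meet-bound : ∀ I B → inB k D B ≡ true → ∀ {t} → t ≤ n → ∣ I ∩ B ∣ + cnt J t ≤ k + cnt I t
  meet-bound I B B∈𝓑 {t} t≤n with blockEnd-extremal I t≤n | inB⇒ B B∈𝓑
  ... | a , a≤ℓ , extremal | ∣B∣≡k , dominates = +-cancelʳ-≤ (cnt I e) _ _ (begin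
    ∣ I ∩ B ∣ + cnt J t + cnt I e          ≡⟨ trans (+-assoc ∣ I ∩ B ∣ _ _) (cong (∣ I ∩ B ∣ +_) (+-comm (cnt J t) _)) ⟩
    ∣ I ∩ B ∣ + (cnt I e + cnt J t)        ≤⟨ +-monoʳ-≤ ∣ I ∩ B ∣ extremal ⟩
    ∣ I ∩ B ∣ + (cnt I t + cnt J e)        ≤⟨ +-monoʳ-≤ ∣ I ∩ B ∣ (+-monoʳ-≤ (cnt I t) (dominates a≤ℓ)) ⟩
    ∣ I ∩ B ∣ + (cnt I t + cnt B e)        ≡⟨ x∙yz≈y∙xz ∣ I ∩ B ∣ (cnt I t) _ ⟩
    cnt I t + (∣ I ∩ B ∣ + cnt B e)        ≤⟨ +-monoʳ-≤ (cnt I t) (∣∩∣+cnt≤ I B (blockEnd≤n a≤ℓ)) ⟩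
    cnt I t + (cnt I e + cnt B n)          ≡⟨ cong (λ x → cnt I t + (cnt I e + x)) ∣B∣≡k ⟩
    cnt I t + (cnt I e + k)                ≡⟨ x∙yz≈zx∙y (cnt I t) (cnt I e) k ⟩
    k + cnt I t + cnt I e                  ∎)
    where
    open ≤-Reasoning
    e = blockEnd a

  -- z is the first gap and y the last element of I, so I is full below z and complete above y, and in
  -- between the exchange raises cnt I by one.  Below z the bound cnt J t ≤ t suffices, sharpened to
  -- t - 1 by 0 ∉ J when y < t.
  exchange-dominated : ∀ {m} I {z y} (z<n : z < n) (y<n : y < n) (z∉I : at↻ I z ≡ false) (y∈I : at↻ I y ≡ true) →
    (∀ v → v < z → at↻ I v ≡ true) → (∀ v → y < v → v < n → at↻ I v ≡ false) → cnt I n ≡ k →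
    (∀ {t} → t ≤ n → cnt J t ≤ cnt I t + suc m) → ∀ {t} → t ≤ n → cnt J t ≤ cnt (exchange I z y) t + m
  exchange-dominated {m} I {z} {y} z<n y<n z∉I y∈I before after ∣I∣≡k dominated {t} t≤n = bound (z <? t) (y <? t)
    where
    open ≤-Reasoning
    I′ = exchange I z y

    shift : ∀ {a b} → (y <ᵇ t) ≡ a → (z <ᵇ t) ≡ b → cnt I′ t + 𝟙 a ≡ cnt I t + 𝟙 b
    shift refl refl = cnt-exchange I z<n y<n z∉I y∈I t≤n

    cnt-before : t ≤ z → cnt I t ≡ t
    cnt-before t≤z = ∑<-one t (λ u u<t → cong 𝟙 (before u (<-≤-trans u<t t≤z)))

    cnt-after : y < t → cnt I t ≡ k
    cnt-after y<t = begin-equality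
      cnt I t                                     ≡⟨ sym (+-identityʳ _) ⟩
      cnt I t + 0                                 ≡⟨ cong (cnt I t +_) (sym (∑<-zero (n ∸ t) none)) ⟩
      cnt I t + ∑[ v < n ∸ t ] 𝟙 (at↻ I (t + v))  ≡⟨ sym (cnt-extend I t≤n) ⟩
      cnt I n                                     ≡⟨ ∣I∣≡k ⟩
      k                                           ∎
      where
      none : ∀ v → v < n ∸ t → 𝟙 (at↻ I (t + v)) ≡ 0
      none v v<n∸t = cong 𝟙 (after (t + v) (<-≤-trans y<t (m≤m+n t v)) (subst (t + v <_) (m+[n∸m]≡n t≤n) (+-monoʳ-< t v<n∸t)))

    bound : Dec (z < t) → Dec (y < t) → cnt J t ≤ cnt I′ t + m
    bound (no z≮t) (no y≮t) = begin
      cnt J t          ≤⟨ cnt≤ J t ⟩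
      t                ≡⟨ sym (cnt-before (≮⇒≥ z≮t)) ⟩
      cnt I t          ≡⟨ sym (+-cancelʳ-≡ 0 _ _ (shift (<ᵇ-false (≮⇒≥ y≮t)) (<ᵇ-false (≮⇒≥ z≮t)))) ⟩
      cnt I′ t         ≤⟨ m≤m+n _ m ⟩
      cnt I′ t + m     ∎
    bound (no z≮t) (yes y<t) = begin
      cnt J t          ≤⟨ <⇒≤pred (cntJ< (≤-<-trans z≤n y<t)) ⟩
      pred t           ≡⟨ cong pred (sym (cnt-before (≮⇒≥ z≮t))) ⟩
      pred (cnt I t)   ≡⟨ cong pred (sym (trans (shift (<ᵇ-true y<t) (<ᵇ-false (≮⇒≥ z≮t))) (+-identityʳ _))) ⟩
      pred (cnt I′ t + 1) ≡⟨ cong pred (+-comm _ 1) ⟩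
      cnt I′ t         ≤⟨ m≤m+n _ m ⟩
      cnt I′ t + m     ∎
    bound (yes z<t) (no y≮t) = begin
      cnt J t          ≤⟨ dominated t≤n ⟩
      cnt I t + suc m  ≡⟨ sym (+-assoc (cnt I t) 1 m) ⟩
      cnt I t + 1 + m  ≡⟨ cong (_+ m) (sym (trans (sym (+-identityʳ _)) (shift (<ᵇ-false (≮⇒≥ y≮t)) (<ᵇ-true z<t)))) ⟩
      cnt I′ t + m     ∎
    bound (yes z<t) (yes y<t) = begin
      cnt J t          ≤⟨ cntJ≤k t≤n ⟩
      k                ≡⟨ sym (cnt-after y<t) ⟩
      cnt I t          ≡⟨ sym (+-cancelʳ-≡ 1 _ _ (shift (<ᵇ-true y<t) (<ᵇ-true z<t))) ⟩
      cnt I′ t         ≤⟨ m≤m+n _ m ⟩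
      cnt I′ t + m     ∎

  𝓑-witness : ∀ m I → cnt I n ≡ k → (∀ {t} → t ≤ n → cnt J t ≤ cnt I t + m) →
    ∃ λ B → inB k D B ≡ true × k ≤ ∣ I ∩ B ∣ + m
  𝓑-witness zero I ∣I∣≡k dominated =
    I , inB⇐ I ∣I∣≡k (λ t≤n → subst (_ ≤_) (+-identityʳ _) (dominated t≤n)) , ≤-reflexive (sym ∣I∩I∣+0≡k)
    where
    ∣I∩I∣+0≡k : ∣ I ∩ I ∣ + 0 ≡ k
    ∣I∩I∣+0≡k = trans (+-identityʳ _) (trans (∣∩∣≡∑< I I) (trans (∑<-cong n (λ u _ → cong 𝟙 (∧-idem (at↻ I u)))) ∣I∣≡k))
  𝓑-witness (suc m) I ∣I∣≡k dominated with first-false (at↻ I) n | last-true (at↻ I) n (subst (0 <_) (sym ∣I∣≡k) 0<k)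
  ... | inj₁ full | _ = ⊥-elim (<-irrefl (trans (sym ∣I∣≡k) (∑<-one n (λ u u<n → cong 𝟙 (full u u<n)))) k<n)
  ... | inj₂ (z , z<n , z∉I , before) | y , y<n , y∈I , after
    with 𝓑-witness m (exchange I z y) (trans (cnt-n-exchange I z<n y<n z∉I y∈I) ∣I∣≡k)
           (exchange-dominated I z<n y<n z∉I y∈I before after ∣I∣≡k dominated)
  ...   | B , B∈𝓑 , k≤ = B , B∈𝓑 , (begin
    k                              ≤⟨ k≤ ⟩
    ∣ exchange I z y ∩ B ∣ + m     ≤⟨ +-monoˡ-≤ m (∣exchange∩∣≤ I z<n y<n z∉I y∈I B) ⟩
    ∣ I ∩ B ∣ + 1 + m              ≡⟨ +-assoc ∣ I ∩ B ∣ 1 m ⟩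
    ∣ I ∩ B ∣ + suc m              ∎)
    where open ≤-Reasoning

  module _ (I : Subset n) (∣I∣≡k : cnt I n ≡ k) where

    maxMeet≤k : maxMeet k D I ≤ k
    maxMeet≤k = maxMeet-lub I λ B B∈𝓑 → subst₂ _≤_ (+-identityʳ _) (+-identityʳ k) (meet-bound I B B∈𝓑 z≤n)

    corank-bound : ∀ {t} → t ≤ n → cnt J t ≤ cnt I t + corank k D I
    corank-bound {t} t≤n = begin
      cnt J t                   ≡⟨ sym (m+n∸n≡m (cnt J t) M) ⟩
      cnt J t + M ∸ M           ≤⟨ ∸-monoˡ-≤ M cntJ+M≤ ⟩
      k + cnt I t ∸ M           ≡⟨ cong (_∸ M) (+-comm k _) ⟩
      cnt I t + k ∸ M           ≡⟨ +-∸-assoc (cnt I t) maxMeet≤k ⟩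
      cnt I t + corank k D I    ∎
      where
      open ≤-Reasoning
      M = maxMeet k D I
      cntJ≤ : cnt J t ≤ k + cnt I t
      cntJ≤ = ≤-trans (cntJ≤k t≤n) (m≤m+n k _)
      cntJ+M≤ : cnt J t + M ≤ k + cnt I t
      cntJ+M≤ = subst (cnt J t + M ≤_) (m+[n∸m]≡n cntJ≤)
        (+-monoʳ-≤ (cnt J t) (maxMeet-lub I λ B B∈𝓑 → m+n≤o⇒m≤o∸n _ (meet-bound I B B∈𝓑 t≤n)))

    corank-least : ∀ {x} → (∀ {t} → t ≤ n → cnt J t ≤ cnt I t + x) → corank k D I ≤ x
    corank-least {x} dominated with 𝓑-witness x I ∣I∣≡k dominated
    ... | B , B∈𝓑 , k≤ = m≤n+o⇒m∸n≤o k (maxMeet k D I) (≤-trans k≤ (+-monoˡ-≤ x (maxMeet-≥ I B B∈𝓑)))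

    corank-attained : ∃ λ t → t ≤ n × cnt J t ≡ cnt I t + corank k D I
    corank-attained with argmax (λ t → cnt J t ∸ cnt I t) n
    ... | t* , t*≤n , maximal with corank k D I ≟ 0
    ...   | yes c≡0 = 0 , z≤n , sym c≡0
    ...   | no c≢0  = t* , t*≤n , ≤-antisym (corank-bound t*≤n) (begin
      cnt I t* + corank k D I
        ≤⟨ +-monoʳ-≤ (cnt I t*) c≤M ⟩
      cnt I t* + (cnt J t* ∸ cnt I t*)
        ≡⟨ m+[n∸m]≡n (<⇒≤ (m∸n≢0⇒n<m {cnt J t*} {cnt I t*} (λ M≡0 → c≢0 (n≤0⇒n≡0 (subst (corank k D I ≤_) M≡0 c≤M))))) ⟩
      cnt J t* ∎)
      where
      open ≤-Reasoning
      c≤M : corank k D I ≤ cnt J t* ∸ cnt I t*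
      c≤M = corank-least λ {t} t≤n → ≤-trans (m≤n+m∸n (cnt J t) (cnt I t)) (+-monoʳ-≤ (cnt I t) (maximal t t≤n))

-- The distance as a potential

Reach-snoc : ∀ {n} {{_ : NonZero n}} {m} {A B C : Subset n} → Reach m A B → Step B C → Reach (suc m) A C
Reach-snoc here        st = there st here
Reach-snoc (there s r) st = there s (Reach-snoc r st)

module Distance {n} {{_ : NonZero n}} {J : Subset n} (k : ℕ) (D : DOSP J) (∣J∣≡k : ∣ J ∣ ≡ k) (0<k : 0 < k) (k<n : k < n) where

  open DOSP D
  open Rotation n start
  open Runs D
  open Corank k D ∣J∣≡k 0<k k<n

  potential : Subset n → ℕ
  potential I = ∑< n (cnt I) + n * corank k D I

  corank-J : corank k D J ≡ 0
  corank-J = n≤0⇒n≡0 (corank-least J cntJ-n (λ _ → ≤-reflexive (sym (+-identityʳ _))))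

  potential-J : potential J ≡ ∑< n (cnt J)
  potential-J = trans (cong (λ c → ∑< n (cnt J) + n * c) corank-J) (trans (cong (∑< n (cnt J) +_) (*-zeroʳ n)) (+-identityʳ _))

  corank-mono : ∀ K K′ {δ} → cnt K n ≡ k → cnt K′ n ≡ k → (∀ {t} → t ≤ n → cnt K t ≤ cnt K′ t + δ) →
    corank k D K′ ≤ corank k D K + δ
  corank-mono K K′ {δ} ∣K∣≡k ∣K′∣≡k K≤K′+δ = corank-least K′ ∣K′∣≡k λ {t} t≤n → begin
    cnt J t                        ≤⟨ corank-bound K ∣K∣≡k t≤n ⟩
    cnt K t + corank k D K         ≤⟨ +-monoˡ-≤ _ (K≤K′+δ t≤n) ⟩
    cnt K′ t + δ + corank k D K    ≡⟨ xy∙z≈x∙zy (cnt K′ t) δ _ ⟩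
    cnt K′ t + (corank k D K + δ)  ∎
    where open ≤-Reasoning

  module _ (K : Subset n) (∣K∣≡k : cnt K n ≡ k) {u} (u∉K : at↻ K u ≡ false) where

    potential-shift : (u+1<n : suc u < n) → at↻ K (suc u) ≡ true → potential (exchange K u (suc u)) ≤ suc (potential K)
    potential-shift u+1<n u+1∈K = begin
      ∑< n (cnt K′) + n * corank k D K′
        ≤⟨ +-monoʳ-≤ _ (*-monoʳ-≤ n (corank-mono K K′ ∣K∣≡k ∣K′∣≡k K≤K′)) ⟩
      ∑< n (cnt K′) + n * (corank k D K + 0)
        ≡⟨ cong₂ (λ s c → s + n * c) (∑cnt-shift K u+1<n u∉K u+1∈K) (+-identityʳ _) ⟩
      suc (potential K) ∎
      where
      open ≤-Reasoning
      K′ = exchange K u (suc u)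
      ∣K′∣≡k = trans (cnt-n-exchange K (<-trans (n<1+n u) u+1<n) u+1<n u∉K u+1∈K) ∣K∣≡k
      K≤K′ : ∀ {t} → t ≤ n → cnt K t ≤ cnt K′ t + 0
      K≤K′ t≤n = ≤-trans (m≤m+n _ _) (≤-reflexive (trans (sym (cnt-shift K u+1<n u∉K u+1∈K t≤n)) (sym (+-identityʳ _))))

    potential-wrap : (u+1≡n : suc u ≡ n) → at↻ K 0 ≡ true → potential (exchange K u 0) ≤ suc (potential K)
    potential-wrap u+1≡n 0∈K = begin
      ∑< n (cnt K′) + n * corank k D K′
        ≤⟨ +-monoʳ-≤ _ (*-monoʳ-≤ n (corank-mono K K′ ∣K∣≡k ∣K′∣≡k (cnt-wrap-≤ K u+1≡n u∉K 0∈K))) ⟩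
      ∑< n (cnt K′) + n * (corank k D K + 1)
        ≡⟨ cong (λ m → ∑< n (cnt K′) + m * (corank k D K + 1)) (sym u+1≡n) ⟩
      ∑< n (cnt K′) + suc u * (corank k D K + 1)
        ≡⟨ rearrange (∑< n (cnt K′)) u (corank k D K) ⟩
      suc (∑< n (cnt K′) + u + suc u * corank k D K)
        ≡⟨ cong₂ (λ s m → suc (s + m * corank k D K)) (∑cnt-wrap K u+1≡n u∉K 0∈K) u+1≡n ⟩
      suc (potential K) ∎
      where
      open ≤-Reasoning
      K′ = exchange K u 0
      ∣K′∣≡k = trans (cnt-n-exchange K (subst (u <_) u+1≡n (n<1+n u)) (>-nonZero⁻¹ n) u∉K 0∈K) ∣K∣≡k
      rearrange : ∀ s u c → s + suc u * (c + 1) ≡ suc (s + u + suc u * c)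
      rearrange = solve-∀

  potential-step : ∀ {K K′} → Step K K′ → cnt K n ≡ k → cnt K′ n ≡ k × potential K′ ≤ suc (potential K)
  potential-step {K} st ∣K∣≡k with step⇒exchange st
  ... | u , u<n , u∉K , u+1∈K , refl =
    trans (cnt-n-exchange K u<n (m%n<n (suc u) n) u∉K u+1∈K) ∣K∣≡k , bound (suc u <? n) u+1∈K
    where
    bound : Dec (suc u < n) → at↻ K (suc u % n) ≡ true → potential (exchange K u (suc u % n)) ≤ suc (potential K)
    bound (yes u+1<n) rewrite m<n⇒m%n≡m u+1<n = potential-shift K ∣K∣≡k u∉K u+1<n
    bound (no u+1≮n) = subst (λ v → at↻ K v ≡ true → potential (exchange K u v) ≤ suc (potential K)) (sym wraps)
                         (potential-wrap K ∣K∣≡k u∉K u+1≡n)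
      where
      u+1≡n = ≤-antisym u<n (≮⇒≥ u+1≮n)
      wraps = trans (cong (_% n) u+1≡n) (n%n≡0 n)

  ∑cnt+corank : ∀ I → ∑[ t < n ] (cnt I t + corank k D I) ≡ potential I
  ∑cnt+corank I = trans (∑<-+ n (cnt I) _) (cong (∑< n (cnt I) +_) (∑<-const n _ (λ _ _ → refl)))

  potential-reach : ∀ {m K I} → Reach m K I → cnt K n ≡ k → potential I ≤ m + potential K
  potential-reach here _ = ≤-refl
  potential-reach {suc m} (there st r) ∣K∣≡k with potential-step st ∣K∣≡k
  ... | ∣K₂∣≡k , stepped = ≤-trans (potential-reach r ∣K₂∣≡k) (≤-trans (+-monoʳ-≤ m stepped) (≤-reflexive (+-suc m _)))

  module Predecessors (I : Subset n) (∣I∣≡k : cnt I n ≡ k) where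

    Slack : ℕ → Set
    Slack t = cnt J t < cnt I t + corank k D I

    Tight : ℕ → Set
    Tight t = cnt J t ≡ cnt I t + corank k D I

    slack-step : ∀ {t} → at↻ I t ≡ true → Slack t → Slack (suc t)
    slack-step {t} t∈I slack = begin-strict
      cnt J t + 𝟙 (at↻ J t)                  ≤⟨ +-monoʳ-≤ (cnt J t) (𝟙≤1 _) ⟩
      cnt J t + 1                            <⟨ +-monoˡ-< 1 slack ⟩
      cnt I t + corank k D I + 1             ≡⟨ xy∙z≈xz∙y (cnt I t) _ 1 ⟩
      cnt I t + 1 + corank k D I             ≡⟨ cong (λ b → cnt I t + 𝟙 b + corank k D I) (sym t∈I) ⟩
      cnt I t + 𝟙 (at↻ I t) + corank k D I   ∎
      where open ≤-Reasoning

    slack-unstep : ∀ {t} → at↻ I t ≡ false → Slack (suc t) → Slack t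
    slack-unstep {t} t∉I slack = ≤-<-trans (m≤m+n (cnt J t) _)
      (subst (λ x → cnt J t + 𝟙 (at↻ J t) < x + corank k D I) (trans (cong (λ b → cnt I t + 𝟙 b) t∉I) (+-identityʳ _)) slack)

    -- Scanning left from a slack point, non-members of I keep the slack, so the first member met is a run end.
    slack-back : ∀ {t₀ t} → t₀ < t → Tight t₀ → Slack t →
      ∃ λ a → t₀ ≤ a × a < t × at↻ I a ≡ true × Slack (suc a) × (suc a ≡ t ⊎ at↻ I (suc a) ≡ false)
    slack-back {t₀} {suc t} t₀<t+1 tight slack with at↻ I t ≟ᵇ true
    ... | yes t∈I = t , s≤s⁻¹ t₀<t+1 , ≤-refl , t∈I , slack , inj₁ refl
    ... | no ¬t∈I with ¬-not ¬t∈I | t₀ ≟ t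
    ...   | t∉I | yes refl = ⊥-elim (<-irrefl tight (slack-unstep t∉I slack))
    ...   | t∉I | no t₀≢t with slack-back (≤∧≢⇒< (s≤s⁻¹ t₀<t+1) t₀≢t) tight (slack-unstep t∉I slack)
    ...     | a , t₀≤a , a<t , a∈I , slack′ , inj₁ refl = a , t₀≤a , m<n⇒m<1+n a<t , a∈I , slack′ , inj₂ t∉I
    ...     | a , t₀≤a , a<t , a∈I , slack′ , inj₂ a+1∉I = a , t₀≤a , m<n⇒m<1+n a<t , a∈I , slack′ , inj₂ a+1∉I

    -- Scanning right along a run of I keeps the slack, so the run must end before the next tight point.
    slack-forward : ∀ d {a t′} → t′ ≡ suc a + d → at↻ I a ≡ true → Slack (suc a) → Tight t′ →
      ∃ λ u → a ≤ u × suc (suc u) ≤ t′ × at↻ I u ≡ true × at↻ I (suc u) ≡ false × Slack (suc u)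
    slack-forward zero    {a} refl a∈I slack tight = ⊥-elim (<-irrefl (subst Tight (+-identityʳ (suc a)) tight) slack)
    slack-forward (suc d) {a} refl a∈I slack tight with at↻ I (suc a) in a+1∈I
    ... | false = a , ≤-refl , s≤s (subst (suc a ≤_) (sym (+-suc a d)) (s≤s (m≤m+n a d))) , a∈I , a+1∈I , slack
    ... | true with slack-forward d (cong suc (+-suc a d)) a+1∈I (slack-step a+1∈I slack) tight
    ...   | u , a<u , u+2≤ , u∈I , u+1∉I , slack′ = u , <⇒≤ a<u , u+2≤ , u∈I , u+1∉I , slack′

    tight-n⇒c≡0 : Tight n → corank k D I ≡ 0
    tight-n⇒c≡0 tight = +-cancelˡ-≡ k _ _
      (trans (cong (_+ corank k D I) (sym ∣I∣≡k)) (trans (sym tight) (trans cntJ-n (sym (+-identityʳ k)))))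

    slack-n : 0 < corank k D I → Slack n
    slack-n 0<c = subst₂ _<_ (sym cntJ-n) (cong (_+ corank k D I) (sym ∣I∣≡k))
      (subst (_< k + corank k D I) (+-identityʳ k) (+-monoʳ-< k 0<c))

    predecessor-site : ∑< n (cnt J) < potential I →
      (∃ λ u → suc u < n × at↻ I u ≡ true × at↻ I (suc u) ≡ false × Slack (suc u))
      ⊎ (at↻ I (pred n) ≡ true × at↻ I 0 ≡ false × 0 < corank k D I)
    predecessor-site J<I with corank k D I ≟ 0
    ... | yes c≡0 with ∑<-<⇒∃< n (cnt J) (λ t → cnt I t + corank k D I) (subst (_ <_) (sym (∑cnt+corank I)) J<I)
    ...   | t , t<n , slack with slack-back (n≢0⇒n>0 t≢0) (sym c≡0) slack
      where
      t≢0 : t ≢ 0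
      t≢0 refl = <-irrefl (sym c≡0) slack
    ...     | a , _ , a<t , a∈I , slack′ , _
      with slack-forward (n ∸ suc a) (sym (m+[n∸m]≡n (<-trans a<t t<n))) a∈I slack′
             (trans cntJ-n (sym (trans (cong₂ _+_ ∣I∣≡k c≡0) (+-identityʳ k))))
    ...       | u , _ , u+2≤n , u∈I , u+1∉I , slack″ = inj₁ (u , u+2≤n , u∈I , u+1∉I , slack″)
    predecessor-site J<I | no c≢0 with corank-attained I ∣I∣≡k
    ... | t₀ , t₀≤n , tight with at↻ I 0 ≟ᵇ true
    ...   | yes 0∈I with slack-forward (t₀ ∸ 1) (sym (m+[n∸m]≡n (n≢0⇒n>0 t₀≢0))) 0∈I slack-1 tight
      where
      t₀≢0 : t₀ ≢ 0
      t₀≢0 refl = c≢0 (sym tight)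
      slack-1 : Slack 1
      slack-1 = subst (_< cnt I 1 + corank k D I) (cong 𝟙 (sym at↻J-0)) (<-≤-trans (n≢0⇒n>0 c≢0) (m≤n+m _ (cnt I 1)))
    ...     | u , _ , u+2≤t₀ , u∈I , u+1∉I , slack′ = inj₁ (u , ≤-trans u+2≤t₀ t₀≤n , u∈I , u+1∉I , slack′)
    predecessor-site J<I | no c≢0 | t₀ , t₀≤n , tight | no 0∉I with at↻ I (pred n) ≟ᵇ true
    ... | yes n-1∈I = inj₂ (n-1∈I , ¬-not 0∉I , n≢0⇒n>0 c≢0)
    ... | no n-1∉I with slack-back (≤∧≢⇒< t₀≤n (λ { refl → c≢0 (tight-n⇒c≡0 tight) })) tight (slack-n (n≢0⇒n>0 c≢0))
    ...   | a , _ , a<n , a∈I , slack′ , a+1≡n⊎a+1∉I = inj₁ (a , ≤∧≢⇒< a<n a+1≢n , a∈I , a+1∉I a+1≡n⊎a+1∉I , slack′)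
      where
      a+1≢n : suc a ≢ n
      a+1≢n a+1≡n = n-1∉I (subst (λ x → at↻ I x ≡ true) (cong pred a+1≡n) a∈I)
      a+1∉I : suc a ≡ n ⊎ at↻ I (suc a) ≡ false → at↻ I (suc a) ≡ false
      a+1∉I = [ ⊥-elim ∘ a+1≢n , id ]′

    Predecessor : Set
    Predecessor = ∃ λ K → Step K I × cnt K n ≡ k × suc (potential K) ≤ potential I

    predecessor-shift : ∀ {u} → suc u < n → at↻ I u ≡ true → at↻ I (suc u) ≡ false → Slack (suc u) → Predecessor
    predecessor-shift {u} u+1<n u∈I u+1∉I slack = K , step , ∣K∣≡k , (begin
      suc (∑< n (cnt K) + n * corank k D K)    ≤⟨ s≤s (+-monoʳ-≤ _ (*-monoʳ-≤ n cK≤cI)) ⟩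
      suc (∑< n (cnt K)) + n * corank k D I    ≡⟨ cong (_+ n * corank k D I) (sym ∑cnt-I) ⟩
      potential I                              ∎)
      where
      open ≤-Reasoning
      u<n = <-trans (n<1+n u) u+1<n
      K = exchange I (suc u) u
      u∉K = at↻-exchange-y I u+1<n u<n u+1∉I u∈I
      u+1∈K = at↻-exchange-z I u+1<n u<n u+1∉I u∈I
      K→I : exchange K u (suc u) ≡ I
      K→I = exchange-exchange I u+1<n u<n u+1∉I u∈I
      step : Step K I
      step = subst (λ v → Step (exchange I v u) I) (m<n⇒m%n≡m u+1<n)
        (exchange⇒step I u<n u∈I (subst (λ v → at↻ I v ≡ false) (sym (m<n⇒m%n≡m u+1<n)) u+1∉I))
      ∣K∣≡k = trans (cnt-n-exchange I u+1<n u<n u+1∉I u∈I) ∣I∣≡k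
      cnt-I : ∀ {t} → t ≤ n → cnt I t ≡ cnt K t + 𝟙 (t ≡ᵇ suc u)
      cnt-I {t} t≤n = subst (λ X → cnt X t ≡ cnt K t + 𝟙 (t ≡ᵇ suc u)) K→I (cnt-shift K u+1<n u∉K u+1∈K t≤n)
      ∑cnt-I : ∑< n (cnt I) ≡ suc (∑< n (cnt K))
      ∑cnt-I = subst (λ X → ∑< n (cnt X) ≡ suc (∑< n (cnt K))) K→I (∑cnt-shift K u+1<n u∉K u+1∈K)
      cK≤cI : corank k D K ≤ corank k D I
      cK≤cI = corank-least K ∣K∣≡k bound
        where
        bound : ∀ {t} → t ≤ n → cnt J t ≤ cnt K t + corank k D I
        bound {t} t≤n with t ≟ suc u
        ... | yes refl = +-cancelʳ-≤ 1 _ _ (subst (cnt J t + 1 ≤_) (trans (cong (_+ corank k D I) (cnt-I t≤n))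
                           (trans (cong (λ b → cnt K t + 𝟙 b + corank k D I) (≡ᵇ-refl t)) (xy∙z≈xz∙y (cnt K t) 1 _)))
                           (subst (_≤ cnt I t + corank k D I) (+-comm 1 _) slack))
        ... | no t≢u+1 = subst (λ x → cnt J t ≤ x + corank k D I)
                           (trans (cnt-I t≤n) (trans (cong (λ b → cnt K t + 𝟙 b) (≡ᵇ-false t≢u+1)) (+-identityʳ _)))
                           (corank-bound I ∣I∣≡k t≤n)

    predecessor-wrap : at↻ I (pred n) ≡ true → at↻ I 0 ≡ false → 0 < corank k D I → Predecessor
    predecessor-wrap n-1∈I 0∉I 0<c = K , step , ∣K∣≡k , (begin
      suc (∑< n (cnt K) + n * corank k D K)
        ≤⟨ s≤s (+-monoʳ-≤ _ (*-monoʳ-≤ n cK≤cI-1)) ⟩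
      suc (∑< n (cnt K) + n * (corank k D I ∸ 1))
        ≡⟨ cong (λ s → suc (s + n * (corank k D I ∸ 1))) (sym ∑cnt-K) ⟩
      suc (∑< n (cnt I) + pred n + n * (corank k D I ∸ 1))
        ≡⟨ cong (λ m → suc (∑< n (cnt I) + pred n + m * (corank k D I ∸ 1))) (sym (suc-pred n)) ⟩
      suc (∑< n (cnt I) + pred n + suc (pred n) * (corank k D I ∸ 1))
        ≡⟨ rearrange (∑< n (cnt I)) (pred n) (corank k D I ∸ 1) ⟩
      ∑< n (cnt I) + suc (pred n) * suc (corank k D I ∸ 1)
        ≡⟨ cong₂ (λ m c → ∑< n (cnt I) + m * c) (suc-pred n) (trans (sym (+-∸-assoc 1 0<c)) refl) ⟩
      potential I ∎)
      where
      open ≤-Reasoning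
      n-1<n = subst (pred n <_) (suc-pred n) (n<1+n (pred n))
      0<n = >-nonZero⁻¹ n
      K = exchange I 0 (pred n)
      n-1∉K = at↻-exchange-y I 0<n n-1<n 0∉I n-1∈I
      0∈K = at↻-exchange-z I 0<n n-1<n 0∉I n-1∈I
      K→I : exchange K (pred n) 0 ≡ I
      K→I = exchange-exchange I 0<n n-1<n 0∉I n-1∈I
      step : Step K I
      step = subst (λ v → Step (exchange I v (pred n)) I) (trans (cong (_% n) (suc-pred n)) (n%n≡0 n))
        (exchange⇒step I n-1<n n-1∈I (subst (λ v → at↻ I v ≡ false) (sym (trans (cong (_% n) (suc-pred n)) (n%n≡0 n))) 0∉I))
      ∣K∣≡k = trans (cnt-n-exchange I 0<n n-1<n 0∉I n-1∈I) ∣I∣≡k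
      ∑cnt-K : ∑< n (cnt I) + pred n ≡ ∑< n (cnt K)
      ∑cnt-K = subst (λ X → ∑< n (cnt X) + pred n ≡ ∑< n (cnt K)) K→I (∑cnt-wrap K (suc-pred n) n-1∉K 0∈K)
      rearrange : ∀ s m c → suc (s + m + suc m * c) ≡ s + suc m * suc c
      rearrange = solve-∀
      cK≤cI-1 : corank k D K ≤ corank k D I ∸ 1
      cK≤cI-1 = corank-least K ∣K∣≡k bound
        where
        bound : ∀ {t} → t ≤ n → cnt J t ≤ cnt K t + (corank k D I ∸ 1)
        bound {t} t≤n with t ≟ 0 | t ≟ n
        ... | yes refl | _        = z≤n
        ... | no _     | yes refl = ≤-trans (≤-reflexive (trans cntJ-n (sym ∣K∣≡k))) (m≤m+n _ _)
        ... | no t≢0   | no t≢n   = begin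
          cnt J t                              ≤⟨ corank-bound I ∣I∣≡k t≤n ⟩
          cnt I t + corank k D I               ≡⟨ cong (cnt I t +_) (sym (m+[n∸m]≡n 0<c)) ⟩
          cnt I t + (1 + (corank k D I ∸ 1))   ≡⟨ sym (+-assoc (cnt I t) 1 _) ⟩
          cnt I t + 1 + (corank k D I ∸ 1)     ≡⟨ cong (_+ (corank k D I ∸ 1)) cnt-K ⟩
          cnt K t + (corank k D I ∸ 1)         ∎
          where
          cnt-K : cnt I t + 1 ≡ cnt K t
          cnt-K = subst (λ X → cnt X t + 1 ≡ cnt K t) K→I (cnt-wrap K (suc-pred n) n-1∉K 0∈K (n≢0⇒n>0 t≢0) (≤∧≢⇒< t≤n t≢n))

    predecessor : ∑< n (cnt J) < potential I → Predecessor
    predecessor J<I with predecessor-site J<I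
    ... | inj₁ (u , u+1<n , u∈I , u+1∉I , slack) = predecessor-shift u+1<n u∈I u+1∉I slack
    ... | inj₂ (n-1∈I , 0∉I , 0<c)               = predecessor-wrap n-1∈I 0∉I 0<c

  open Predecessors using (predecessor)

  potential-J≤ : ∀ I → cnt I n ≡ k → ∑< n (cnt J) ≤ potential I
  potential-J≤ I ∣I∣≡k = subst (_ ≤_) (∑cnt+corank I) (∑<-mono n (λ t t<n → corank-bound I ∣I∣≡k (<⇒≤ t<n)))

  potential-minimal⇒J : ∀ I → cnt I n ≡ k → potential I ≤ ∑< n (cnt J) → I ≡ J
  potential-minimal⇒J I ∣I∣≡k minimal = at↻-ext I J λ u u<n →
    𝟙-injective (+-cancelˡ-≡ (cnt I u) _ _ (trans (same (suc u) u<n) (cong (_+ 𝟙 (at↻ J u)) (sym (same u (<⇒≤ u<n))))))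
    where
    tight : ∀ t → t < n → cnt J t ≡ cnt I t + corank k D I
    tight = ∑<-pointwise n (cnt J) (λ t → cnt I t + corank k D I) (λ t t<n → corank-bound I ∣I∣≡k (<⇒≤ t<n))
      (≤-antisym (∑<-mono n (λ t t<n → corank-bound I ∣I∣≡k (<⇒≤ t<n))) (subst (_≤ ∑< n (cnt J)) (sym (∑cnt+corank I)) minimal))
    c≡0 : corank k D I ≡ 0
    c≡0 = sym (tight 0 (>-nonZero⁻¹ n))
    same : ∀ t → t ≤ n → cnt I t ≡ cnt J t
    same t t≤n with m≤n⇒m<n∨m≡n t≤n
    ... | inj₁ t<n  = sym (trans (tight t t<n) (trans (cong (cnt I t +_) c≡0) (+-identityʳ _)))
    ... | inj₂ refl = trans ∣I∣≡k (sym cntJ-n)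

  reach : ∀ v I → cnt I n ≡ k → potential I ≤ v + ∑< n (cnt J) → ∃ λ m → m ≤ v × Reach m J I
  reach zero    I ∣I∣≡k bound = 0 , z≤n , subst (Reach 0 J) (sym (potential-minimal⇒J I ∣I∣≡k bound)) here
  reach (suc v) I ∣I∣≡k bound with potential I ≤? ∑< n (cnt J)
  ... | yes minimal = 0 , z≤n , subst (Reach 0 J) (sym (potential-minimal⇒J I ∣I∣≡k minimal)) here
  ... | no J<I with predecessor I ∣I∣≡k (≰⇒> J<I)
  ...   | K , st , ∣K∣≡k , K<I with reach v K ∣K∣≡k (s≤s⁻¹ (≤-trans K<I bound))
  ...     | m , m≤v , r = suc m , s≤s m≤v , Reach-snoc r st

  distance : ∀ d → IsDistFrom k J d → ∀ I → ∣ I ∣ ≡ k → d I + ∑< n (cnt J) ≡ potential I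
  distance d isDist I ∣I∣≡k′ = within (reach (potential I ∸ ∑< n (cnt J)) I ∣I∣≡k (≤-reflexive (sym (m∸n+n≡m J≤I))))
    where
    ∣I∣≡k = trans (sym (∣∣≡cnt I)) ∣I∣≡k′
    J≤I = potential-J≤ I ∣I∣≡k
    within : (∃ λ m → m ≤ potential I ∸ ∑< n (cnt J) × Reach m J I) → d I + ∑< n (cnt J) ≡ potential I
    within (m , m≤v , r) = ≤-antisym
      (subst (d I + ∑< n (cnt J) ≤_) (m∸n+n≡m J≤I) (+-monoˡ-≤ _ (≤-trans (proj₂ (isDist I ∣I∣≡k′) m r) m≤v)))
      (subst (λ p → potential I ≤ d I + p) potential-J (potential-reach (proj₁ (isDist I ∣I∣≡k′)) cntJ-n))

-- Rational arithmetic and the lineality space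

open import Data.Integer as ℤ using (ℤ; +_)
import Data.Integer.Properties as ℤ
open import Data.Integer.Tactic.RingSolver using () renaming (solve-∀ to solveℤ)
open import Data.Rational using (ℚ; _/_; _-_; fromℚᵘ) renaming (_+_ to _+ℚ_; -_ to -ℚ_)
import Data.Rational.Properties as ℚ
open import Data.Rational.Unnormalised as ℚᵘ using (ℚᵘ; mkℚᵘ; *≡*)
import Data.Rational.Unnormalised.Properties as ℚᵘ

fromℚᵘ-+ : ∀ p q → fromℚᵘ (p ℚᵘ.+ q) ≡ fromℚᵘ p +ℚ fromℚᵘ q
fromℚᵘ-+ p q = ℚ.toℚᵘ-injective (ℚᵘ.≃-trans (ℚ.toℚᵘ-fromℚᵘ (p ℚᵘ.+ q))
  (ℚᵘ.≃-sym (ℚᵘ.≃-trans (ℚ.toℚᵘ-homo-+ (fromℚᵘ p) (fromℚᵘ q)) (ℚᵘ.+-cong (ℚ.toℚᵘ-fromℚᵘ p) (ℚ.toℚᵘ-fromℚᵘ q)))))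

fromℚᵘ-neg : ∀ p → fromℚᵘ (ℚᵘ.- p) ≡ -ℚ fromℚᵘ p
fromℚᵘ-neg p = ℚ.toℚᵘ-injective (ℚᵘ.≃-trans (ℚ.toℚᵘ-fromℚᵘ (ℚᵘ.- p))
  (ℚᵘ.≃-sym (ℚᵘ.≃-trans (ℚ.toℚᵘ-homo‿- (fromℚᵘ p)) (ℚᵘ.-‿cong (ℚ.toℚᵘ-fromℚᵘ p)))))

-- fromℚᵘ (mkℚᵘ a m) reduces to a / suc m; callers pass a product denominator suc m * suc k
-- through its reduct suc (k + m * suc k).
/-cross : ∀ {a b m n} → a ℤ.* + suc n ≡ b ℤ.* + suc m → a / suc m ≡ b / suc n
/-cross {a} {b} {m} {n} eq = ℚ.fromℚᵘ-cong {mkℚᵘ a m} {mkℚᵘ b n} (*≡* eq)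

/-+-/ : ∀ a b m → a / suc m +ℚ b / suc m ≡ (a ℤ.+ b) / suc m
/-+-/ a b m = trans (sym (fromℚᵘ-+ (mkℚᵘ a m) (mkℚᵘ b m))) (/-cross {a ℤ.* + suc m ℤ.+ b ℤ.* + suc m} {a ℤ.+ b} {m + m * suc m} {m} (begin
    (a ℤ.* + suc m ℤ.+ b ℤ.* + suc m) ℤ.* + suc m   ≡⟨ factor a b (+ suc m) ⟩
    (a ℤ.+ b) ℤ.* (+ suc m ℤ.* + suc m)             ≡⟨ cong ((a ℤ.+ b) ℤ.*_) (sym (ℤ.pos-* (suc m) (suc m))) ⟩
    (a ℤ.+ b) ℤ.* + (suc m * suc m)                 ∎))
  where
  open ≡-Reasoning
  factor : ∀ a b s → (a ℤ.* s ℤ.+ b ℤ.* s) ℤ.* s ≡ (a ℤ.+ b) ℤ.* (s ℤ.* s)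
  factor = solveℤ

/-minus-integer : ∀ a b m → a / suc m - b / 1 ≡ (a ℤ.- b ℤ.* + suc m) / suc m
/-minus-integer a b m = begin
  a / suc m - b / 1
    ≡⟨ cong (a / suc m +ℚ_) (sym (fromℚᵘ-neg (mkℚᵘ b 0))) ⟩
  a / suc m +ℚ (ℤ.- b) / 1
    ≡⟨ sym (fromℚᵘ-+ (mkℚᵘ a m) (mkℚᵘ (ℤ.- b) 0)) ⟩
  (a ℤ.* + 1 ℤ.+ (ℤ.- b) ℤ.* + suc m) / (suc m * 1)
    ≡⟨ /-cross {a = a ℤ.* + 1 ℤ.+ (ℤ.- b) ℤ.* + suc m} {b = a ℤ.- b ℤ.* + suc m} {m = m * 1} {n = m} (tidy a b (+ suc m)) ⟩
  (a ℤ.- b ℤ.* + suc m) / suc m ∎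
  where
  open ≡-Reasoning
  tidy : ∀ a b s → (a ℤ.* + 1 ℤ.+ (ℤ.- b) ℤ.* s) ℤ.* s ≡ (a ℤ.- b ℤ.* s) ℤ.* (s ℤ.* + 1)
  tidy = solveℤ

∑ℤ : ∀ {m} → Subset m → (Fin m → ℤ) → ℤ
∑ℤ []      y = + 0
∑ℤ (b ∷ I) y = (if b then y fzero else + 0) ℤ.+ ∑ℤ I (λ i → y (fsuc i))

sumOver-/ : ∀ {m} (I : Subset m) (y : Fin m → ℤ) N → sumOver I (λ p → y p / suc N) ≡ ∑ℤ I y / suc N
sumOver-/ []          y N = sym (ℚ.0/n≡0 (suc N))
sumOver-/ (true ∷ I)  y N = trans (cong (y fzero / suc N +ℚ_) (sumOver-/ I (λ i → y (fsuc i)) N)) (/-+-/ (y fzero) _ N)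
sumOver-/ (false ∷ I) y N = trans (ℚ.+-identityˡ _)
  (trans (sumOver-/ I (λ i → y (fsuc i)) N) (cong (_/ suc N) (sym (ℤ.+-identityˡ (∑ℤ I (λ i → y (fsuc i)))))))

∑ℤ-affine : ∀ {m} (I : Subset m) (f : ℕ → ℕ) c →
  ∑ℤ I (λ p → + f (toℕ p) ℤ.- + c) ≡ + ∑[ p < m ] (𝟙 (at I p) * f p) ℤ.- + (∣ I ∣ * c)
∑ℤ-affine []                  f c = refl
∑ℤ-affine {suc m} (true ∷ I)  f c = begin
  (+ f 0 ℤ.- + c) ℤ.+ ∑ℤ I (λ p → + f (suc (toℕ p)) ℤ.- + c)
    ≡⟨ cong (λ s → (+ f 0 ℤ.- + c) ℤ.+ s) (∑ℤ-affine I (f ∘ suc) c) ⟩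
  (+ f 0 ℤ.- + c) ℤ.+ (+ rest ℤ.- + (∣ I ∣ * c))
    ≡⟨ regroup (+ f 0) (+ rest) (+ c) (+ (∣ I ∣ * c)) ⟩
  (+ f 0 ℤ.+ + rest) ℤ.- (+ c ℤ.+ + (∣ I ∣ * c))
    ≡⟨ cong₂ ℤ._-_ (sym (ℤ.pos-+ (f 0) rest)) (sym (ℤ.pos-+ c (∣ I ∣ * c))) ⟩
  + (f 0 + rest) ℤ.- + (suc ∣ I ∣ * c)
    ≡⟨ cong (λ x → + x ℤ.- + (suc ∣ I ∣ * c))
      (trans (cong (_+ rest) (sym (+-identityʳ (f 0)))) (sym (∑<-head m _))) ⟩
  + ∑[ p < suc m ] (𝟙 (at (true ∷ I) p) * f p) ℤ.- + (suc ∣ I ∣ * c) ∎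
  where
  open ≡-Reasoning
  rest = ∑[ p < m ] (𝟙 (at I p) * f (suc p))
  regroup : ∀ a s c C → (a ℤ.- c) ℤ.+ (s ℤ.- C) ≡ (a ℤ.+ s) ℤ.- (c ℤ.+ C)
  regroup = solveℤ
∑ℤ-affine {suc m} (false ∷ I) f c = trans (ℤ.+-identityˡ _) (trans (∑ℤ-affine I (f ∘ suc) c)
  (cong (λ x → + x ℤ.- + (∣ I ∣ * c)) (sym (∑<-head m (λ p → 𝟙 (at (false ∷ I) p) * f p)))))

/-scale : ∀ a m k → a / suc m ≡ (+ suc k ℤ.* a) / (suc m * suc k)
/-scale a m k = /-cross {a} {+ suc k ℤ.* a} {m} {k + m * suc k} (begin
  a ℤ.* + (suc m * suc k)               ≡⟨ cong (a ℤ.*_) (ℤ.pos-* (suc m) (suc k)) ⟩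
  a ℤ.* (+ suc m ℤ.* + suc k)           ≡⟨ commute a (+ suc m) (+ suc k) ⟩
  + suc k ℤ.* a ℤ.* + suc m             ∎)
  where
  open ≡-Reasoning
  commute : ∀ a m k → a ℤ.* (m ℤ.* k) ≡ k ℤ.* a ℤ.* m
  commute = solveℤ

pos-difference : ∀ {d s t n c} → d + s ≡ t + n * c → + d ℤ.- + c ℤ.* + n ≡ + t ℤ.- + s
pos-difference {d} {s} {t} {n} {c} eq = begin
  + d ℤ.- + c ℤ.* + n
    ≡⟨ expand (+ d) (+ s) (+ c ℤ.* + n) ⟩
  (+ d ℤ.+ + s) ℤ.- + s ℤ.- + c ℤ.* + n
    ≡⟨ cong (λ x → x ℤ.- + s ℤ.- + c ℤ.* + n) (trans (sym (ℤ.pos-+ d s)) (cong +_ eq)) ⟩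
  + (t + n * c) ℤ.- + s ℤ.- + c ℤ.* + n
    ≡⟨ cong (λ x → x ℤ.- + s ℤ.- + c ℤ.* + n) (trans (ℤ.pos-+ t (n * c)) (cong (λ x → + t ℤ.+ x) (ℤ.pos-* n c))) ⟩
  (+ t ℤ.+ + n ℤ.* + c) ℤ.- + s ℤ.- + c ℤ.* + n
    ≡⟨ collapse (+ t) (+ s) (+ n) (+ c) ⟩
  + t ℤ.- + s ∎
  where
  open ≡-Reasoning
  expand : ∀ d s e → d ℤ.- e ≡ (d ℤ.+ s) ℤ.- s ℤ.- e
  expand = solveℤ
  collapse : ∀ t s n c → (t ℤ.+ n ℤ.* c) ℤ.- s ℤ.- c ℤ.* n ≡ t ℤ.- s
  collapse = solveℤ

affine/≡sumOver : ∀ {m} n k (I : Subset m) (w : ℕ → ℕ) s → ∣ I ∣ ≡ suc k →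
  (+ ∑[ p < m ] (𝟙 (at I p) * w p) ℤ.- + s) / suc n ≡ sumOver I (λ p → (+ (suc k * w (toℕ p)) ℤ.- + s) / (suc n * suc k))
affine/≡sumOver {m} n k I w s ∣I∣≡k = begin
  (+ ∑[ p < m ] (𝟙 (at I p) * w p) ℤ.- + s) / suc n
    ≡⟨ /-scale (+ ∑[ p < m ] (𝟙 (at I p) * w p) ℤ.- + s) n k ⟩
  (+ suc k ℤ.* (+ ∑[ p < m ] (𝟙 (at I p) * w p) ℤ.- + s)) / (suc n * suc k)
    ≡⟨ cong (_/ (suc n * suc k)) numerator ⟩
  ∑ℤ I (λ p → + (suc k * w (toℕ p)) ℤ.- + s) / (suc n * suc k)
    ≡⟨ sym (sumOver-/ I _ (k + n * suc k)) ⟩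
  sumOver I (λ p → (+ (suc k * w (toℕ p)) ℤ.- + s) / (suc n * suc k))
    ∎
  where
  open ≡-Reasoning
  numerator : + suc k ℤ.* (+ ∑[ p < m ] (𝟙 (at I p) * w p) ℤ.- + s) ≡ ∑ℤ I (λ p → + (suc k * w (toℕ p)) ℤ.- + s)
  numerator = sym (begin
    ∑ℤ I (λ p → + (suc k * w (toℕ p)) ℤ.- + s)
      ≡⟨ ∑ℤ-affine I (λ p → suc k * w p) s ⟩
    + ∑[ p < m ] (𝟙 (at I p) * (suc k * w p)) ℤ.- + (∣ I ∣ * s)
      ≡⟨ cong₂ (λ a b → + a ℤ.- + (b * s))
        (trans (∑<-cong m (λ p _ → swap (𝟙 (at I p)) (suc k) (w p))) (∑<-*ˡ m (suc k) _))
        ∣I∣≡k ⟩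
    + (suc k * ∑[ p < m ] (𝟙 (at I p) * w p)) ℤ.- + (suc k * s)
      ≡⟨ cong₂ ℤ._-_ (ℤ.pos-* (suc k) (∑[ p < m ] (𝟙 (at I p) * w p))) (ℤ.pos-* (suc k) s) ⟩
    + suc k ℤ.* + ∑[ p < m ] (𝟙 (at I p) * w p) ℤ.- + suc k ℤ.* + s
      ≡⟨ sym (distrib (+ suc k) (+ ∑[ p < m ] (𝟙 (at I p) * w p)) (+ s)) ⟩
    + suc k ℤ.* (+ ∑[ p < m ] (𝟙 (at I p) * w p) ℤ.- + s) ∎)
    where
    distrib : ∀ K a s → K ℤ.* (a ℤ.- s) ≡ K ℤ.* a ℤ.- K ℤ.* s
    distrib = solveℤ
    swap : ∀ a b c → a * (b * c) ≡ b * (a * c)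
    swap = solve-∀

mainTheorem8 : (n k : ℕ) {{_ : NonZero n}} → 2 ≤ k → k < n →
    (J : Subset n) → ∣ J ∣ ≡ k → NonCyclic k J → (D : DOSP J) →
    (d : Subset n → ℕ) → IsDistFrom k J d →
    Σ (Fin n → ℚ) λ x → ∀ (I : Subset n) → ∣ I ∣ ≡ k →
      ((+ d I) / n) - ((+ corank k D I) / 1) ≡ sumOver I x
mainTheorem8 n@(suc n′) k@(suc k′) _ k<n J ∣J∣≡k _ D d isDist = x , λ I ∣I∣≡k → begin
  (+ d I) / n - (+ corank k D I) / 1
    ≡⟨ /-minus-integer (+ d I) (+ corank k D I) n′ ⟩
  (+ d I ℤ.- + corank k D I ℤ.* + n) / n
    ≡⟨ cong (_/ n) (pos-difference {t = ∑< n (cnt I)} {n} {corank k D I} (distance d isDist I ∣I∣≡k)) ⟩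
  (+ ∑< n (cnt I) ℤ.- + ∑< n (cnt J)) / n
    ≡⟨ cong (λ a → (+ a ℤ.- + ∑< n (cnt J)) / n) (∑cnt≡weighted I) ⟩
  (+ ∑[ p < n ] (𝟙 (at I p) * weight p) ℤ.- + ∑< n (cnt J)) / n
    ≡⟨ affine/≡sumOver n′ k′ I weight (∑< n (cnt J)) ∣I∣≡k ⟩
  sumOver I x ∎
  where
  open ≡-Reasoning
  open Rotation n (DOSP.start D)
  open Distance k D ∣J∣≡k z<s k<n
  x : Fin n → ℚ
  x p = (+ (k * weight (toℕ p)) ℤ.- + ∑< n (cnt J)) / (n * k)
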